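{- Let $\Gamma$ be a connected, non-complete strongly regular graph with parameters $(\nu,k,\lambda,\mu)$, and let $s$ be its smallest eigenvalue. If $\omega(\Gamma)<1-\frac{k}{s}$ or $\alpha(\Gamma)<\frac{\nu s}{s-k}$, then $\Gamma$ is separating. In particular, if either $\frac{k}{s}$ or $\frac{\nu s}{s-k}$ is not an integer, then $\Gamma$ is separating. Conversely, $\Gamma$ is non-separating if and only if $\omega(\Gamma)=1-\frac{k}{s}$ and $\alpha(\Gamma)=\frac{\nu s}{s-k}$.
   Context: A graph is strongly regular with parameters $(\nu,k,\lambda,\mu)$ if it has $\nu$ vertices, is $k$-regular, every two adjacent vertices have exactly $\lambda$ common neighbours and every two distinct non-adjacent vertices have exactly $\mu$ common neighbours. Its smallest eigenvalue is $s=\frac{\lambda-\mu-\sqrt{(\lambda-\mu)^2+4(k-\mu)}}{2}$. $\omega(\Gamma)$ and $\alpha(\Gamma)$ denote the maximum sizes of a clique and of a coclique (independent set) of $\Gamma$. A graph $\Gamma$ is called separating if $\omega(\Gamma)\alpha(\Gamma)<|V(\Gamma)|$, and non-separating otherwise. -}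

module Defs where

open import Data.Nat as ℕ using (ℕ; zero; suc; _≤_; _<_)
open import Data.Integer as ℤ using (ℤ; +_)
open import Data.Rational.Base as Q using (ℚ; 0ℚ; 1ℚ)
open import Data.Rational.Properties as QP using ()
open import Data.Bool using (Bool; true; false)
open import Data.Fin using (Fin; zero; suc)
open import Data.Product using (Σ; ∃; _×_; _,_)
open import Relation.Nullary using (¬_; yes; no)
open import Relation.Binary.PropositionalEquality using (_≡_; _≢_)

record Graph (n : ℕ) : Set where
  field
    adj   : Fin n → Fin n → Bool
    sym   : ∀ u v → adj u v ≡ adj v u
    irref : ∀ v → adj v v ≡ false
open Graph public

count : ∀ {n} → (Fin n → Bool) → ℕ
count {zero}  P = 0
count {suc n} P with P zero
... | true  = suc (count (λ i → P (suc i)))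
... | false = count (λ i → P (suc i))

_∧b_ : Bool → Bool → Bool
true  ∧b b = b
false ∧b _ = false

degree : ∀ {n} → Graph n → Fin n → ℕ
degree G v = count (adj G v)

commonNeighbours : ∀ {n} → Graph n → Fin n → Fin n → ℕ
commonNeighbours G u v = count (λ w → adj G u w ∧b adj G v w)

record IsSRG {ν : ℕ} (G : Graph ν) (k l μ : ℕ) : Set where
  field
    regular  : ∀ v → degree G v ≡ k
    adjacent : ∀ u v → u ≢ v → adj G u v ≡ true  → commonNeighbours G u v ≡ l
    nonadj   : ∀ u v → u ≢ v → adj G u v ≡ false → commonNeighbours G u v ≡ μ

data Walk {n : ℕ} (G : Graph n) : Fin n → Fin n → Set where
  here : ∀ {v} → Walk G v v
  step : ∀ {u v w} → adj G u v ≡ true → Walk G v w → Walk G u w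

Connected : ∀ {n} → Graph n → Set
Connected G = ∀ u v → Walk G u v

NonComplete : ∀ {n} → Graph n → Set
NonComplete G = Σ _ λ u → Σ _ λ v → (u ≢ v) × (adj G u v ≡ false)

IsClique : ∀ {n} → Graph n → (Fin n → Bool) → Set
IsClique G S = ∀ u v → S u ≡ true → S v ≡ true → u ≢ v → adj G u v ≡ true

IsCoclique : ∀ {n} → Graph n → (Fin n → Bool) → Set
IsCoclique G S = ∀ u v → S u ≡ true → S v ≡ true → adj G u v ≡ false

IsCliqueNumber : ∀ {n} → Graph n → ℕ → Set
IsCliqueNumber G w =
  (Σ _ λ S → IsClique G S × count S ≡ w) × (∀ S → IsClique G S → count S ≤ w)

IsCocliqueNumber : ∀ {n} → Graph n → ℕ → Set
IsCocliqueNumber G a =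
  (Σ _ λ S → IsCoclique G S × count S ≡ a) × (∀ S → IsCoclique G S → count S ≤ a)

Separating : ∀ {n} → Graph n → Set
Separating {n} G = ∀ w a → IsCliqueNumber G w → IsCocliqueNumber G a → w ℕ.* a < n

NonSeparating : ∀ {n} → Graph n → Set
NonSeparating G = ¬ Separating G

-- Exact real arithmetic in ℚ(√D) for an integer D ≥ 0:
-- a value ⟨ a , b ⟩ denotes the real number a + b·√D.

record Surd : Set where
  constructor ⟨_,_⟩
  field
    re : ℚ
    ir : ℚ
open Surd public

module SurdOps (D : ℤ) where
  Dq : ℚ
  Dq = D Q./ 1

  fromℚ : ℚ → Surd
  fromℚ q = ⟨ q , 0ℚ ⟩

  fromℤ : ℤ → Surd
  fromℤ z = fromℚ (z Q./ 1)

  fromℕ : ℕ → Surd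
  fromℕ n = fromℤ (+ n)

  √D : Surd
  √D = ⟨ 0ℚ , 1ℚ ⟩

  infixl 6 _+S_ _-S_
  infixl 7 _*S_ _/S_
  infix 4 _<S_ _≈S_

  _+S_ : Surd → Surd → Surd
  ⟨ a , b ⟩ +S ⟨ c , e ⟩ = ⟨ a Q.+ c , b Q.+ e ⟩

  -S_ : Surd → Surd
  -S ⟨ a , b ⟩ = ⟨ Q.- a , Q.- b ⟩

  _-S_ : Surd → Surd → Surd
  x -S y = x +S (-S y)

  _*S_ : Surd → Surd → Surd
  ⟨ a , b ⟩ *S ⟨ c , e ⟩ = ⟨ a Q.* c Q.+ b Q.* e Q.* Dq , a Q.* e Q.+ b Q.* c ⟩

  inv : ℚ → ℚ
  inv q with q QP.≟ 0ℚ
  ... | yes _  = 0ℚ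
  ... | no q≢0 = Q.1/_ q {{Q.≢-nonZero q≢0}}

  -- multiplicative inverse (of a nonzero value; 0 is sent to 0)
  invS : Surd → Surd
  invS ⟨ c , e ⟩ with (c Q.* c Q.- e Q.* e Q.* Dq) QP.≟ 0ℚ
  ... | no _  = let N = c Q.* c Q.- e Q.* e Q.* Dq
                in ⟨ c Q.* inv N , Q.- (e Q.* inv N) ⟩
  ... | yes _ = -- then √D = |c|/|e| is rational (or c = e = 0)
                ⟨ inv (c Q.+ e Q.* (Q.∣ c ∣ Q.* inv Q.∣ e ∣)) , 0ℚ ⟩

  _/S_ : Surd → Surd → Surd
  x /S y = x *S invS y

  data Sign : Set where
    neg zer pos : Sign

  signQ : ℚ → Sign
  signQ q with q QP.≟ 0ℚ
  ... | yes _ = zer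
  ... | no _ with q QP.<? 0ℚ
  ...   | yes _ = neg
  ...   | no _  = pos

  signS : Surd → Sign
  signS ⟨ a , b ⟩ with D ℤ.≟ ℤ.0ℤ | signQ a | signQ b
  ... | yes _ | sa  | _   = sa
  ... | no _  | sa  | zer = sa
  ... | no _  | zer | sb  = sb
  ... | no _  | pos | pos = pos
  ... | no _  | neg | neg = neg
  ... | no _  | pos | neg = signQ (a Q.* a Q.- b Q.* b Q.* Dq)
  ... | no _  | neg | pos = signQ (b Q.* b Q.* Dq Q.- a Q.* a)

  _<S_ : Surd → Surd → Set
  x <S y = signS (y -S x) ≡ pos

  _≈S_ : Surd → Surd → Set
  x ≈S y = signS (x -S y) ≡ zer

  IsInteger : Surd → Set
  IsInteger x = ∃ λ (z : ℤ) → x ≈S fromℤ z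

disc : ℕ → ℕ → ℕ → ℤ
disc k l μ = (+ l ℤ.- + μ) ℤ.* (+ l ℤ.- + μ) ℤ.+ + 4 ℤ.* (+ k ℤ.- + μ)

-- smallest eigenvalue s = (λ - μ - √((λ-μ)² + 4(k-μ))) / 2
smallestEV : ℕ → ℕ → ℕ → Surd
smallestEV k l μ = ⟨ (+ l ℤ.- + μ) Q./ 2 , Q.- (+ 1 Q./ 2) ⟩

-- Counting, for a clique (coclique) T, the neighbours in T of each vertex outside T and
-- applying Cauchy–Schwarz gives the Delsarte bound ω ≤ 1 - k/s (the Hoffman bound
-- α ≤ νs/(s - k)) in a polynomial form free of s.  The product of the two bounds is ν:
-- over ℤ this becomes the fact that a monic quadratic with nonpositive constant term,
-- nonnegative at k(ν - α) and nonpositive at αk(ω - 1), has its positive root between them,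
-- so ωα ≤ ν with equality iff both polynomials vanish.  Finally each difference
-- bound - value is computed exactly in ℚ(√D) as a positive multiple of A + B√D with
-- integers A, B, and it vanishes exactly when the corresponding polynomial does.
module Submission where

open import Defs
  using (Graph; IsSRG; Connected; NonComplete; IsCliqueNumber; IsCocliqueNumber; Separating; NonSeparating;
         module SurdOps; disc; smallestEV)
open import Data.Nat using (ℕ)
open import Data.Product using (_×_; _,_; proj₁; proj₂)
open import Data.Sum using (_⊎_; inj₁; inj₂)
open import Relation.Nullary using (¬_)
open import Function.Base using (_∘_)
open import Function.Bundles using (_⇔_)
open import Function.Construct.Composition using (_⇔-∘_)
open import Function.Construct.Symmetry using (⇔-sym)

module Integers where

  open import Data.Nat using (zero; z≤n; s≤s)
  open import Data.Integer
    using (+_; -[1+_]; +[1+_]; 0ℤ; 1ℤ; _*_; _-_; -_; _≤_; _<_; +≤+; +<+)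
  import Data.Integer.Properties as ℤP
  open import Data.Empty using (⊥-elim)
  open import Data.Sum using (_⊎_; inj₁; inj₂)
  open import Relation.Binary.PropositionalEquality

  *-nonNeg : ∀ {i j} → 0ℤ ≤ i → 0ℤ ≤ j → 0ℤ ≤ i * j
  *-nonNeg {+ m} {+ n} _ _ = subst (0ℤ ≤_) (ℤP.pos-* m n) (+≤+ z≤n)

  *-pos : ∀ {i j} → 0ℤ < i → 0ℤ < j → 0ℤ < i * j
  *-pos {+[1+ m ]} {+[1+ n ]} _ _ = +<+ (s≤s z≤n)
  *-pos {+[1+ m ]} {+ zero}   _ (+<+ ())
  *-pos {+ zero}    (+<+ ()) _

  square-nonNeg : ∀ i → 0ℤ ≤ i * i
  square-nonNeg (+ m)    = *-nonNeg {+ m} {+ m} (+≤+ z≤n) (+≤+ z≤n)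
  square-nonNeg -[1+ m ] = +≤+ z≤n

  *-cancelˡ-nonNeg : ∀ {i j} → 0ℤ < i → 0ℤ ≤ i * j → 0ℤ ≤ j
  *-cancelˡ-nonNeg {+[1+ m ]} {j} _ h =
    ℤP.*-cancelˡ-≤-pos 0ℤ j +[1+ m ] (subst (_≤ +[1+ m ] * j) (sym (ℤP.*-zeroʳ +[1+ m ])) h)
  *-cancelˡ-nonNeg {+ zero} (+<+ ())

  *-cancelˡ-pos : ∀ {i j} → 0ℤ < i → 0ℤ < i * j → 0ℤ < j
  *-cancelˡ-pos {+[1+ m ]} {j} _ h =
    ℤP.*-cancelˡ-<-nonNeg +[1+ m ] (subst (_< +[1+ m ] * j) (sym (ℤP.*-zeroʳ +[1+ m ])) h)
  *-cancelˡ-pos {+ zero} (+<+ ())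

  *-cancelˡ-zero : ∀ {i j} → 0ℤ < i → i * j ≡ 0ℤ → j ≡ 0ℤ
  *-cancelˡ-zero {i} i>0 e with ℤP.i*j≡0⇒i≡0∨j≡0 i e
  ... | inj₂ j≡0 = j≡0
  ... | inj₁ refl = ⊥-elim (ℤP.<-irrefl refl i>0)

  nonNeg-zero⊎pos : ∀ {i} → 0ℤ ≤ i → i ≡ 0ℤ ⊎ 0ℤ < i
  nonNeg-zero⊎pos {+ zero}    _ = inj₁ refl
  nonNeg-zero⊎pos {+[1+ n ]} _ = inj₂ (+<+ (s≤s z≤n))

  1≤⇒pos : ∀ {i} → 1ℤ ≤ i → 0ℤ < i
  1≤⇒pos {+[1+ n ]} _ = +<+ (s≤s z≤n)
  1≤⇒pos {+ zero} (+≤+ ())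

  *-cancelˡ-neg : ∀ {i j} → 0ℤ < i → i * j < 0ℤ → j < 0ℤ
  *-cancelˡ-neg {i} {j} i>0 h = subst (_< 0ℤ) (ℤP.neg-involutive j)
    (ℤP.neg-mono-< (*-cancelˡ-pos i>0 (subst (0ℤ <_) (ℤP.neg-distribʳ-* i j) (ℤP.neg-mono-< h))))

  *-cancelʳ-zero : ∀ {i j} → 0ℤ < j → i * j ≡ 0ℤ → i ≡ 0ℤ
  *-cancelʳ-zero {i} {j} j>0 e = *-cancelˡ-zero j>0 (trans (ℤP.*-comm j i) e)

  i<j⇒0<j-i : ∀ {i j} → i < j → 0ℤ < j - i
  i<j⇒0<j-i {i} {j} i<j = subst (_< j - i) (ℤP.+-inverseʳ i) (ℤP.+-monoˡ-< (- i) i<j)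

  neg*pos≤0 : ∀ {i j} → i < 0ℤ → 0ℤ < j → i * j ≤ 0ℤ
  neg*pos≤0 {i} {j} i<0 j>0 = ℤP.<⇒≤ (subst (_< 0ℤ) (trans (cong -_ (sym (ℤP.neg-distribˡ-* i j))) (ℤP.neg-involutive (i * j)))
    (ℤP.neg-mono-< (*-pos (ℤP.neg-mono-< i<0) j>0)))

module FinSums where

  open import Data.Nat as ℕ using (ℕ; zero; suc; z≤n; s≤s)
  open import Data.Integer using (ℤ; +_; 0ℤ; 1ℤ; _+_; _*_; _-_; -_; _≤_; +≤+; +<+)
  import Data.Integer.Properties as ℤP
  open import Data.Bool using (Bool; true; false)
  open import Data.Fin using (Fin; zero; suc)
  open import Data.Fin.Properties using (_≟_)
  open import Relation.Nullary.Decidable using (does; dec-true; dec-false)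
  open import Relation.Binary.PropositionalEquality
  open import Data.Integer.Tactic.RingSolver using (solve-∀)
  open import Defs using (count)
  open Integers

  open import Algebra.Properties.Semiring.Sum ℤP.+-*-semiring public
    using (sum; sum-syntax; sum-cong-≗; ∑-distrib-+; ∑-comm; *-distribˡ-sum; sum-replicate-zero)

  ⟦_⟧ : Bool → ℤ
  ⟦ true  ⟧ = 1ℤ
  ⟦ false ⟧ = 0ℤ

  δ : ∀ {n} → Fin n → Fin n → ℤ
  δ i j = ⟦ does (i ≟ j) ⟧

  variable
    n : ℕ

  ∑-*ˡ : ∀ c (f : Fin n → ℤ) → ∑[ i < n ] (c * f i) ≡ c * sum f
  ∑-*ˡ c f = sym (*-distribˡ-sum c f)

  ∑-*ʳ : ∀ c (f : Fin n → ℤ) → ∑[ i < n ] (f i * c) ≡ sum f * c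
  ∑-*ʳ c f = trans (sum-cong-≗ (λ i → ℤP.*-comm (f i) c)) (trans (∑-*ˡ c f) (ℤP.*-comm c (sum f)))

  ∑-distrib-- : ∀ (f g : Fin n → ℤ) → ∑[ i < n ] (f i - g i) ≡ sum f - sum g
  ∑-distrib-- f g = begin
    ∑[ i < _ ] (f i - g i)           ≡⟨ ∑-distrib-+ f (λ i → - g i) ⟩
    sum f + ∑[ i < _ ] (- g i)       ≡⟨ cong (λ t → sum f + t) (sum-cong-≗ (λ i → sym (ℤP.-1*i≡-i (g i)))) ⟩
    sum f + ∑[ i < _ ] (- 1ℤ * g i)  ≡⟨ cong (λ t → sum f + t) (trans (∑-*ˡ (- 1ℤ) g) (ℤP.-1*i≡-i (sum g))) ⟩
    sum f - sum g                    ∎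
    where open ≡-Reasoning

  ∑-zero : ∑[ i < n ] 0ℤ ≡ 0ℤ
  ∑-zero {n} = sum-replicate-zero n

  ∑-one : ∑[ i < n ] 1ℤ ≡ + n
  ∑-one {zero}  = refl
  ∑-one {suc n} = trans (cong (λ t → 1ℤ + t) ∑-one) (sym (ℤP.pos-+ 1 n))

  ∑-product : ∀ (f g : Fin n → ℤ) → ∑[ i < n ] ∑[ j < n ] (f i * g j) ≡ sum f * sum g
  ∑-product f g = trans (sum-cong-≗ (λ i → ∑-*ˡ (f i) g)) (∑-*ʳ (sum g) f)

  ∑-nonNeg : ∀ (f : Fin n → ℤ) → (∀ i → 0ℤ ≤ f i) → 0ℤ ≤ sum f
  ∑-nonNeg {zero}  f f≥0 = +≤+ z≤n
  ∑-nonNeg {suc n} f f≥0 = ℤP.+-mono-≤ (f≥0 zero) (∑-nonNeg (λ i → f (suc i)) (λ i → f≥0 (suc i)))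

  ∑-mono-≤ : ∀ (f g : Fin n → ℤ) → (∀ i → f i ≤ g i) → sum f ≤ sum g
  ∑-mono-≤ {zero}  f g f≤g = +≤+ z≤n
  ∑-mono-≤ {suc n} f g f≤g =
    ℤP.+-mono-≤ (f≤g zero) (∑-mono-≤ (λ i → f (suc i)) (λ i → g (suc i)) (λ i → f≤g (suc i)))

  term≤∑ : ∀ (f : Fin n → ℤ) → (∀ i → 0ℤ ≤ f i) → ∀ i → f i ≤ sum f
  term≤∑ f f≥0 zero = subst (_≤ sum f) (ℤP.+-identityʳ (f zero))
    (ℤP.+-monoʳ-≤ (f zero) (∑-nonNeg (λ i → f (suc i)) (λ i → f≥0 (suc i))))
  term≤∑ f f≥0 (suc i) = subst (_≤ sum f) (ℤP.+-identityˡ (f (suc i)))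
    (ℤP.+-mono-≤ (f≥0 zero) (term≤∑ (λ i → f (suc i)) (λ i → f≥0 (suc i)) i))

  δ-refl : ∀ (i : Fin n) → δ i i ≡ 1ℤ
  δ-refl i = cong ⟦_⟧ (dec-true (i ≟ i) refl)

  δ-≢ : ∀ {i j : Fin n} → i ≢ j → δ i j ≡ 0ℤ
  δ-≢ {i = i} {j} i≢j = cong ⟦_⟧ (dec-false (i ≟ j) i≢j)

  ∑-δ : ∀ (i : Fin n) (f : Fin n → ℤ) → ∑[ j < n ] (δ j i * f j) ≡ f i
  ∑-δ {suc n} zero f = begin
    1ℤ * f zero + ∑[ j < n ] (0ℤ * f (suc j)) ≡⟨ cong₂ _+_ (ℤP.*-identityˡ (f zero)) (sum-cong-≗ (λ j → ℤP.*-zeroˡ (f (suc j)))) ⟩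
    f zero + ∑[ j < n ] 0ℤ                    ≡⟨ cong (λ t → f zero + t) (∑-zero {n}) ⟩
    f zero + 0ℤ                               ≡⟨ ℤP.+-identityʳ (f zero) ⟩
    f zero                                    ∎
    where open ≡-Reasoning
  ∑-δ {suc n} (suc i) f = trans (ℤP.+-identityˡ _) (∑-δ i (λ j → f (suc j)))

  count≡∑ : ∀ (P : Fin n → Bool) → + count P ≡ ∑[ i < n ] ⟦ P i ⟧
  count≡∑ {zero}  P = refl
  count≡∑ {suc n} P with P zero
  ... | true  = trans (ℤP.pos-+ 1 (count (λ i → P (suc i)))) (cong (λ t → 1ℤ + t) (count≡∑ (λ i → P (suc i))))
  ... | false = trans (count≡∑ (λ i → P (suc i))) (sym (ℤP.+-identityˡ _))

  -- Σᵥ Σ_w o_v o_w (f_v - f_w)² = 2 (Σ o · Σ o f² - (Σ o f)²) ≥ 0.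
  cauchy-schwarz : ∀ (o f : Fin n → ℤ) → (∀ i → 0ℤ ≤ o i) →
    ∑[ i < n ] (o i * f i) * ∑[ i < n ] (o i * f i) ≤ sum o * ∑[ i < n ] (o i * f i * f i)
  cauchy-schwarz {n} o f o≥0 =
    ℤP.0≤i-j⇒j≤i (*-cancelˡ-nonNeg {+ 2} (+<+ (s≤s z≤n)) (subst (0ℤ ≤_) doubleSum≡ doubleSum≥0))
    where
    m X Y : ℤ
    m = sum o
    X = ∑[ i < n ] (o i * f i)
    Y = ∑[ i < n ] (o i * f i * f i)
    term : Fin n → Fin n → ℤ
    term v w = o v * o w * ((f v - f w) * (f v - f w))
    doubleSum≥0 : 0ℤ ≤ ∑[ v < n ] ∑[ w < n ] term v w
    doubleSum≥0 = ∑-nonNeg _ (λ v → ∑-nonNeg _ (λ w →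
      *-nonNeg (*-nonNeg (o≥0 v) (o≥0 w)) (square-nonNeg (f v - f w))))
    expand : ∀ a b x y → a * b * ((x - y) * (x - y)) ≡ ((a * x * x) * b + a * (b * y * y)) - + 2 * ((a * x) * (b * y))
    expand = solve-∀
    collect : ∀ m X Y → (Y * m + m * Y) - + 2 * (X * X) ≡ + 2 * (m * Y - X * X)
    collect = solve-∀
    square-terms cross-terms : Fin n → Fin n → ℤ
    square-terms v w = (o v * f v * f v) * o w + o v * (o w * f w * f w)
    cross-terms v w = + 2 * ((o v * f v) * (o w * f w))
    doubleSum≡ : ∑[ v < n ] ∑[ w < n ] term v w ≡ + 2 * (m * Y - X * X)
    doubleSum≡ = begin
      ∑[ v < n ] ∑[ w < n ] term v w
        ≡⟨ sum-cong-≗ (λ v → trans (sum-cong-≗ (λ w → expand (o v) (o w) (f v) (f w)))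
                                   (∑-distrib-- (square-terms v) (cross-terms v))) ⟩
      ∑[ v < n ] (sum (square-terms v) - sum (cross-terms v))
        ≡⟨ ∑-distrib-- (λ v → sum (square-terms v)) (λ v → sum (cross-terms v)) ⟩
      ∑[ v < n ] sum (square-terms v) - ∑[ v < n ] sum (cross-terms v)
        ≡⟨ cong₂ _-_
             (trans (sum-cong-≗ (λ v → ∑-distrib-+ (λ w → (o v * f v * f v) * o w) (λ w → o v * (o w * f w * f w))))
                    (∑-distrib-+ (λ v → ∑[ w < n ] ((o v * f v * f v) * o w)) (λ v → ∑[ w < n ] (o v * (o w * f w * f w)))))
             (trans (sum-cong-≗ (λ v → ∑-*ˡ (+ 2) (λ w → (o v * f v) * (o w * f w))))
                    (∑-*ˡ (+ 2) (λ v → ∑[ w < n ] ((o v * f v) * (o w * f w))))) ⟩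
      (∑[ v < n ] ∑[ w < n ] ((o v * f v * f v) * o w) + ∑[ v < n ] ∑[ w < n ] (o v * (o w * f w * f w)))
        - + 2 * ∑[ v < n ] ∑[ w < n ] ((o v * f v) * (o w * f w))
        ≡⟨ cong₂ (λ a b → a - + 2 * b)
             (cong₂ _+_ (∑-product (λ v → o v * f v * f v) o) (∑-product o (λ w → o w * f w * f w)))
             (∑-product (λ v → o v * f v) (λ w → o w * f w)) ⟩
      (Y * m + m * Y) - + 2 * (X * X)
        ≡⟨ collect m X Y ⟩
      + 2 * (m * Y - X * X) ∎
      where open ≡-Reasoning

module Graphs where

  open import Data.Nat as ℕ using (ℕ)
  open import Data.Integer using (ℤ; +_; 1ℤ; _+_; _*_; _≤_; +≤+)
  import Data.Integer.Properties as ℤP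
  open import Data.Bool using (Bool; true; false; _∨_)
  open import Data.Fin using (Fin)
  open import Data.Fin.Properties using (_≟_)
  open import Data.Empty using (⊥-elim)
  open import Data.Product using (_,_)
  open import Data.Sum using (_⊎_; inj₁; inj₂)
  open import Relation.Nullary using (yes; no)
  open import Relation.Nullary.Decidable using (does)
  open import Relation.Binary.PropositionalEquality
  open import Defs hiding (sym)
  open FinSums

  adjacency : ∀ {n} → Graph n → Fin n → Fin n → ℤ
  adjacency G u v = ⟦ adj G u v ⟧

  module _ {n : ℕ} (G : Graph n) where

    record InducedPath₂ : Set where
      field
        p q r : Fin n
        p≢q   : p ≢ q
        p≁q   : adj G p q ≡ false
        p∼r   : adj G p r ≡ true
        r∼q   : adj G r q ≡ true

    -- Follow a walk from a closed neighbourhood of u to the non-neighbour v: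
    -- the first step leaving it is an induced path of length 2 from u.
    private
      leaveNeighbourhood : ∀ u {x v} → x ≡ u ⊎ adj G u x ≡ true → Walk G x v →
                           v ≢ u → adj G u v ≡ false → InducedPath₂
      leaveNeighbourhood u (inj₁ refl) here v≢u _ = ⊥-elim (v≢u refl)
      leaveNeighbourhood u (inj₂ u∼v) here _ u≁v with trans (sym u∼v) u≁v
      ... | ()
      leaveNeighbourhood u {x} x∈N[u] (step {v = y} x∼y walk) v≢u u≁v with y ≟ u
      ... | yes y≡u = leaveNeighbourhood u (inj₁ y≡u) walk v≢u u≁v
      ... | no y≢u with adj G u y in u?y
      ...   | true = leaveNeighbourhood u (inj₂ u?y) walk v≢u u≁v
      ...   | false with x∈N[u]
      ...     | inj₁ refl with trans (sym x∼y) u?y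
      ...       | ()
      leaveNeighbourhood u {x} _ (step {v = y} x∼y _) _ _ | no y≢u | false | inj₂ u∼x =
        record { p = u ; q = y ; r = x ; p≢q = ≢-sym y≢u ; p≁q = u?y ; p∼r = u∼x ; r∼q = x∼y }

    inducedPath₂ : Connected G → NonComplete G → InducedPath₂
    inducedPath₂ conn (u , v , u≢v , u≁v) = leaveNeighbourhood u (inj₁ refl) (conn u v) (≢-sym u≢v) u≁v

    singleton : Fin n → Fin n → Bool
    singleton p w = does (w ≟ p)

    pair : Fin n → Fin n → Fin n → Bool
    pair p r w = singleton p w ∨ singleton r w

    singleton-member : ∀ {p w} → singleton p w ≡ true → w ≡ p
    singleton-member {p} {w} with w ≟ p
    ... | yes w≡p = λ _ → w≡p
    ... | no _    = λ ()

    pair-member : ∀ {p r w} → pair p r w ≡ true → w ≡ p ⊎ w ≡ r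
    pair-member {p} {r} {w} with w ≟ p | w ≟ r
    ... | yes w≡p | _       = λ _ → inj₁ w≡p
    ... | no _    | yes w≡r = λ _ → inj₂ w≡r
    ... | no _    | no _    = λ ()

    singleton-coclique : ∀ p → IsCoclique G (singleton p)
    singleton-coclique p x y x∈ y∈ with singleton-member {p} {x} x∈ | singleton-member {p} {y} y∈
    ... | refl | refl = irref G x

    pair-clique : ∀ {p r} → adj G p r ≡ true → IsClique G (pair p r)
    pair-clique {p} {r} p∼r x y x∈ y∈ x≢y with pair-member {p} {r} {x} x∈ | pair-member {p} {r} {y} y∈
    ... | inj₁ refl | inj₁ refl = ⊥-elim (x≢y refl)
    ... | inj₁ refl | inj₂ refl = p∼r
    ... | inj₂ refl | inj₁ refl = trans (Graph.sym G r p) p∼r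
    ... | inj₂ refl | inj₂ refl = ⊥-elim (x≢y refl)

    count-singleton : ∀ p → count (singleton p) ≡ 1
    count-singleton p = ℤP.+-injective (begin
      + count (singleton p)      ≡⟨ count≡∑ (singleton p) ⟩
      ∑[ w < n ] δ w p           ≡⟨ sum-cong-≗ (λ w → sym (ℤP.*-identityʳ (δ w p))) ⟩
      ∑[ w < n ] (δ w p * 1ℤ)    ≡⟨ ∑-δ p (λ _ → 1ℤ) ⟩
      1ℤ                         ∎)
      where open ≡-Reasoning

    count-pair : ∀ {p r} → p ≢ r → count (pair p r) ≡ 2
    count-pair {p} {r} p≢r = ℤP.+-injective (begin
      + count (pair p r)                          ≡⟨ count≡∑ (pair p r) ⟩
      ∑[ w < n ] ⟦ pair p r w ⟧                   ≡⟨ sum-cong-≗ indicator ⟩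
      ∑[ w < n ] (δ w p * 1ℤ + δ w r * 1ℤ)        ≡⟨ ∑-distrib-+ (λ w → δ w p * 1ℤ) (λ w → δ w r * 1ℤ) ⟩
      ∑[ w < n ] (δ w p * 1ℤ) + ∑[ w < n ] (δ w r * 1ℤ) ≡⟨ cong₂ _+_ (∑-δ p (λ _ → 1ℤ)) (∑-δ r (λ _ → 1ℤ)) ⟩
      + 2                                         ∎)
      where
      open ≡-Reasoning
      indicator : ∀ w → ⟦ pair p r w ⟧ ≡ δ w p * 1ℤ + δ w r * 1ℤ
      indicator w with w ≟ p | w ≟ r
      ... | yes refl | yes refl = ⊥-elim (p≢r refl)
      ... | yes _    | no _     = refl
      ... | no _     | yes _    = refl
      ... | no _     | no _     = refl

    count≤size : ∀ (T : Fin n → Bool) → count T ℕ.≤ n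
    count≤size T = ℤP.drop‿+≤+ (begin
      + count T           ≡⟨ count≡∑ T ⟩
      ∑[ w < n ] ⟦ T w ⟧  ≤⟨ ∑-mono-≤ (λ w → ⟦ T w ⟧) (λ _ → 1ℤ) (λ w → ⟦⟧≤1 (T w)) ⟩
      ∑[ w < n ] 1ℤ       ≡⟨ ∑-one ⟩
      + n                 ∎)
      where
      open ℤP.≤-Reasoning
      ⟦⟧≤1 : ∀ b → ⟦ b ⟧ ≤ 1ℤ
      ⟦⟧≤1 true  = +≤+ (ℕ.s≤s ℕ.z≤n)
      ⟦⟧≤1 false = +≤+ ℕ.z≤n

module StronglyRegular where

  open import Data.Nat as ℕ using (ℕ)
  open import Data.Integer using (ℤ; +_; 0ℤ; 1ℤ; _+_; _*_; _-_; -_; _≤_; _<_; +≤+)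
  import Data.Integer.Properties as ℤP
  open import Data.Bool using (Bool; true; false)
  open import Data.Fin using (Fin)
  open import Data.Fin.Properties using (_≟_)
  open import Relation.Nullary using (Dec; yes; no)
  open import Relation.Binary.PropositionalEquality
  open import Data.Sum using (_⊎_; inj₁; inj₂)
  open import Data.Product using (_×_; _,_)
  open import Data.Integer.Tactic.RingSolver using (solve-∀)
  open import Defs hiding (sym)
  open Integers
  open FinSums
  open Graphs

  -- With s the smallest eigenvalue and c ≥ 0, delsartePoly k λ μ c ≥ 0 says c ≤ 1 - k/s and
  -- hoffmanPoly ν k μ c ≥ 0 says c ≤ ν s/(s - k); these are the bounds of the theorem, free of √.
  delsartePoly : ℤ → ℤ → ℤ → ℤ → ℤ
  delsartePoly k l μ c = k * k + (l - μ) * k * (c - 1ℤ) - (k - μ) * (c - 1ℤ) * (c - 1ℤ)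

  hoffmanPoly : ℤ → ℤ → ℤ → ℤ → ℤ
  hoffmanPoly ν k μ c = (ν - c) * (c * μ + (k - μ)) - c * k * k

  module _ {n : ℕ} (G : Graph n) {k l μ : ℕ} (srg : IsSRG G k l μ) where

    open IsSRG srg

    private
      A : Fin n → Fin n → ℤ
      A = adjacency G

    rowSum : ∀ u → sum (A u) ≡ + k
    rowSum u = trans (sym (count≡∑ (adj G u))) (cong +_ (regular u))

    A-sym : ∀ u v → A u v ≡ A v u
    A-sym u v = cong ⟦_⟧ (Graph.sym G u v)

    A-diag : ∀ u → A u u ≡ 0ℤ
    A-diag u = cong ⟦_⟧ (irref G u)

    A² : Fin n → Fin n → ℤ
    A² u v = ∑[ w < n ] (A u w * A v w)

    commonNeighbourCount : Bool → ℕ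
    commonNeighbourCount true  = l
    commonNeighbourCount false = μ

    A²-diag : ∀ u → A² u u ≡ + k
    A²-diag u = trans (sum-cong-≗ (λ w → idempotent (adj G u w))) (rowSum u)
      where
      idempotent : ∀ b → ⟦ b ⟧ * ⟦ b ⟧ ≡ ⟦ b ⟧
      idempotent true  = refl
      idempotent false = refl

    A²-offDiag : ∀ {u v b} → u ≢ v → adj G u v ≡ b → A² u v ≡ + commonNeighbourCount b
    A²-offDiag {u} {v} {b} u≢v adj≡b = begin
      A² u v                                ≡⟨ sum-cong-≗ (λ w → ⟦∧⟧ (adj G u w) (adj G v w)) ⟨
      ∑[ w < n ] ⟦ adj G u w ∧b adj G v w ⟧ ≡⟨ count≡∑ (λ w → adj G u w ∧b adj G v w) ⟨
      + commonNeighbours G u v              ≡⟨ cong +_ (common b adj≡b) ⟩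
      + commonNeighbourCount b              ∎
      where
      open ≡-Reasoning
      ⟦∧⟧ : ∀ x y → ⟦ x ∧b y ⟧ ≡ ⟦ x ⟧ * ⟦ y ⟧
      ⟦∧⟧ true  y = sym (ℤP.*-identityˡ ⟦ y ⟧)
      ⟦∧⟧ false y = refl
      common : ∀ b → adj G u v ≡ b → commonNeighbours G u v ≡ commonNeighbourCount b
      common true  = adjacent u v u≢v
      common false = nonadj u v u≢v

    nonNeighbour : Fin n → Fin n → ℤ
    nonNeighbour u w = 1ℤ - A u w - δ w u

    ∑-nonNeighbour : ∀ u → sum (nonNeighbour u) ≡ + n - + k - 1ℤ
    ∑-nonNeighbour u = begin
      ∑[ w < n ] (1ℤ - A u w - δ w u)          ≡⟨ ∑-distrib-- (λ w → 1ℤ - A u w) (λ w → δ w u) ⟩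
      ∑[ w < n ] (1ℤ - A u w) - ∑[ w < n ] δ w u
        ≡⟨ cong₂ _-_ (trans (∑-distrib-- (λ _ → 1ℤ) (A u)) (cong₂ _-_ ∑-one (rowSum u)))
                     (trans (sum-cong-≗ (λ w → sym (ℤP.*-identityʳ (δ w u)))) (∑-δ u (λ _ → 1ℤ))) ⟩
      + n - + k - 1ℤ                             ∎
      where open ≡-Reasoning

    nonNeighbour-cases : ∀ u w → Dec (w ≡ u) →
      nonNeighbour u w ≡ 0ℤ ⊎ (nonNeighbour u w ≡ 1ℤ × w ≢ u × adj G u w ≡ false)
    nonNeighbour-cases u w (yes refl) = inj₁ (cong₂ (λ a d → 1ℤ - a - d) (A-diag w) (δ-refl w))
    nonNeighbour-cases u w (no w≢u) with adj G u w
    ... | true  = inj₁ (cong (λ d → 1ℤ - 1ℤ - d) (δ-≢ w≢u))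
    ... | false = inj₂ (cong (λ d → 1ℤ - 0ℤ - d) (δ-≢ w≢u) , w≢u , refl)

    nonNeighbour-nonNeg : ∀ u w → 0ℤ ≤ nonNeighbour u w
    nonNeighbour-nonNeg u w with nonNeighbour-cases u w (w ≟ u)
    ... | inj₁ e           = ℤP.≤-reflexive (sym e)
    ... | inj₂ (e , _ , _) = ℤP.≤-trans (+≤+ ℕ.z≤n) (ℤP.≤-reflexive (sym e))

    -- Count the edges between the neighbours of u and its other non-neighbours.
    parameterRelation : Fin n → (+ n - + k - 1ℤ) * + μ ≡ + k * (+ k - + l - 1ℤ)
    parameterRelation u = begin
      (+ n - + k - 1ℤ) * + μ                     ≡⟨ cong (_* + μ) (∑-nonNeighbour u) ⟨
      sum nonNbr * + μ                           ≡⟨ ∑-*ʳ (+ μ) nonNbr ⟨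
      ∑[ w < n ] (nonNbr w * + μ)                ≡⟨ sum-cong-≗ nonNbr-A² ⟨
      ∑[ w < n ] (nonNbr w * A² u w)             ≡⟨ sum-cong-≗ (λ w → trans (sym (∑-*ˡ (nonNbr w) (λ y → A u y * A w y)))
                                                      (sum-cong-≗ (λ y → reassoc (nonNbr w) (A u y) (A w y)))) ⟩
      ∑[ w < n ] ∑[ y < n ] (A u y * (nonNbr w * A w y)) ≡⟨ ∑-comm (λ w y → A u y * (nonNbr w * A w y)) ⟩
      ∑[ y < n ] ∑[ w < n ] (A u y * (nonNbr w * A w y)) ≡⟨ sum-cong-≗ (λ y → trans (∑-*ˡ (A u y) (λ w → nonNbr w * A w y))
                                                                          (cong (A u y *_) (∑-nonNbr-A y))) ⟩
      ∑[ y < n ] (A u y * (+ k - A² u y - A u y)) ≡⟨ sum-cong-≗ nbr-A² ⟩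
      ∑[ y < n ] (A u y * (+ k - + l - 1ℤ))      ≡⟨ ∑-*ʳ (+ k - + l - 1ℤ) (A u) ⟩
      sum (A u) * (+ k - + l - 1ℤ)               ≡⟨ cong (_* (+ k - + l - 1ℤ)) (rowSum u) ⟩
      + k * (+ k - + l - 1ℤ)                     ∎
      where
      open ≡-Reasoning
      nonNbr : Fin n → ℤ
      nonNbr = nonNeighbour u

      reassoc : ∀ p q r → p * (q * r) ≡ q * (p * r)
      reassoc = solve-∀

      nonNbr-A² : ∀ w → nonNbr w * A² u w ≡ nonNbr w * + μ
      nonNbr-A² w with nonNeighbour-cases u w (w ≟ u)
      ... | inj₁ e = trans (cong (_* A² u w) e) (cong (_* + μ) (sym e))
      ... | inj₂ (_ , w≢u , u≁w) = cong (nonNbr w *_) (A²-offDiag (≢-sym w≢u) u≁w)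

      ∑-nonNbr-A : ∀ y → ∑[ w < n ] (nonNbr w * A w y) ≡ + k - A² u y - A u y
      ∑-nonNbr-A y = begin
        ∑[ w < n ] (nonNbr w * A w y)
          ≡⟨ sum-cong-≗ (λ w → expand (A u w) (δ w u) (A w y)) ⟩
        ∑[ w < n ] ((A w y - A u w * A w y) - δ w u * A w y)
          ≡⟨ ∑-distrib-- (λ w → A w y - A u w * A w y) (λ w → δ w u * A w y) ⟩
        ∑[ w < n ] (A w y - A u w * A w y) - ∑[ w < n ] (δ w u * A w y)
          ≡⟨ cong₂ _-_ (∑-distrib-- (λ w → A w y) (λ w → A u w * A w y)) (∑-δ u (λ w → A w y)) ⟩
        ∑[ w < n ] A w y - ∑[ w < n ] (A u w * A w y) - A u y
          ≡⟨ cong₂ (λ a b → a - b - A u y) (trans (sum-cong-≗ (λ w → A-sym w y)) (rowSum y))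
                                            (sum-cong-≗ (λ w → cong (A u w *_) (A-sym w y))) ⟩
        + k - A² u y - A u y ∎
        where
        expand : ∀ p q r → (1ℤ - p - q) * r ≡ (r - p * r) - q * r
        expand = solve-∀

      A≡0⊎A²≡λ : ∀ y → A u y ≡ 0ℤ ⊎ (A u y ≡ 1ℤ × A² u y ≡ + l)
      A≡0⊎A²≡λ y with adj G u y in u?y
      ... | false = inj₁ refl
      ... | true  = inj₂ (refl , A²-offDiag u≢y u?y)
        where
        u≢y : u ≢ y
        u≢y refl with trans (sym u?y) (irref G u)
        ... | ()

      nbr-A² : ∀ y → A u y * (+ k - A² u y - A u y) ≡ A u y * (+ k - + l - 1ℤ)
      nbr-A² y with A≡0⊎A²≡λ y
      ... | inj₁ e        rewrite e = refl
      ... | inj₂ (e , e²) rewrite e² | e = refl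

    module _ (P : InducedPath₂ G) where

      open InducedPath₂ P

      μ≥1 : 1ℤ ≤ + μ
      μ≥1 = begin
        1ℤ                  ≡⟨ cong₂ (λ a b → ⟦ a ⟧ * ⟦ b ⟧) p∼r (trans (Graph.sym G q r) r∼q) ⟨
        A p r * A q r       ≤⟨ term≤∑ (λ w → A p w * A q w) (λ w → *-nonNeg (⟦⟧-nonNeg (adj G p w)) (⟦⟧-nonNeg (adj G q w))) r ⟩
        A² p q              ≡⟨ A²-offDiag p≢q p≁q ⟩
        + μ                 ∎
        where
        open ℤP.≤-Reasoning
        ⟦⟧-nonNeg : ∀ b → 0ℤ ≤ ⟦ b ⟧
        ⟦⟧-nonNeg true  = +≤+ ℕ.z≤n
        ⟦⟧-nonNeg false = +≤+ ℕ.z≤n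

      μ≤k : + μ ≤ + k
      μ≤k = begin
        + μ          ≡⟨ A²-offDiag p≢q p≁q ⟨
        A² p q       ≤⟨ ∑-mono-≤ (λ w → A p w * A q w) (A p) (λ w → ⟦⟧*⟦⟧≤⟦⟧ (adj G p w) (adj G q w)) ⟩
        sum (A p)    ≡⟨ rowSum p ⟩
        + k          ∎
        where
        open ℤP.≤-Reasoning
        ⟦⟧*⟦⟧≤⟦⟧ : ∀ a b → ⟦ a ⟧ * ⟦ b ⟧ ≤ ⟦ a ⟧
        ⟦⟧*⟦⟧≤⟦⟧ true  true  = ℤP.≤-refl
        ⟦⟧*⟦⟧≤⟦⟧ true  false = +≤+ ℕ.z≤n
        ⟦⟧*⟦⟧≤⟦⟧ false _     = ℤP.≤-refl

      ν-k-1≥1 : 1ℤ ≤ + n - + k - 1ℤ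
      ν-k-1≥1 = begin
        1ℤ                      ≡⟨ cong₂ (λ a d → 1ℤ - a - d) (cong ⟦_⟧ p≁q) (δ-≢ (≢-sym p≢q)) ⟨
        nonNeighbour p q        ≤⟨ term≤∑ (nonNeighbour p) (nonNeighbour-nonNeg p) q ⟩
        sum (nonNeighbour p)    ≡⟨ ∑-nonNeighbour p ⟩
        + n - + k - 1ℤ          ∎
        where open ℤP.≤-Reasoning

      k>0 : 0ℤ < + k
      k>0 = 1≤⇒pos (ℤP.≤-trans μ≥1 μ≤k)

      μ>0 : 0ℤ < + μ
      μ>0 = 1≤⇒pos μ≥1

      k-λ-1>0 : 0ℤ < + k - + l - 1ℤ
      k-λ-1>0 = *-cancelˡ-pos k>0 (subst (0ℤ <_) (parameterRelation p) (*-pos (1≤⇒pos ν-k-1≥1) μ>0))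

    module VertexSet (T : Fin n → Bool) where

      size : ℤ
      size = ∑[ v < n ] ⟦ T v ⟧

      neighboursIn : Fin n → ℤ
      neighboursIn v = ∑[ u < n ] (⟦ T u ⟧ * A u v)

      ∑-neighboursIn : sum neighboursIn ≡ size * + k
      ∑-neighboursIn = begin
        ∑[ v < n ] ∑[ u < n ] (⟦ T u ⟧ * A u v) ≡⟨ ∑-comm (λ v u → ⟦ T u ⟧ * A u v) ⟩
        ∑[ u < n ] ∑[ v < n ] (⟦ T u ⟧ * A u v) ≡⟨ sum-cong-≗ (λ u → trans (∑-*ˡ ⟦ T u ⟧ (A u)) (cong (⟦ T u ⟧ *_) (rowSum u))) ⟩
        ∑[ u < n ] (⟦ T u ⟧ * + k)              ≡⟨ ∑-*ʳ (+ k) (λ u → ⟦ T u ⟧) ⟩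
        size * + k                               ∎
        where open ≡-Reasoning

      ∑-neighboursIn² : ∑[ v < n ] (neighboursIn v * neighboursIn v)
                      ≡ ∑[ u < n ] (⟦ T u ⟧ * ∑[ u′ < n ] (⟦ T u′ ⟧ * A² u u′))
      ∑-neighboursIn² = begin
        ∑[ v < n ] (neighboursIn v * neighboursIn v)
          ≡⟨ sum-cong-≗ (λ v → trans (sym (∑-*ʳ (neighboursIn v) (λ u → ⟦ T u ⟧ * A u v)))
               (sum-cong-≗ (λ u → sym (∑-*ˡ (⟦ T u ⟧ * A u v) (λ u′ → ⟦ T u′ ⟧ * A u′ v))))) ⟩
        ∑[ v < n ] ∑[ u < n ] ∑[ u′ < n ] (term v u u′)
          ≡⟨ ∑-comm (λ v u → ∑[ u′ < n ] term v u u′) ⟩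
        ∑[ u < n ] ∑[ v < n ] ∑[ u′ < n ] (term v u u′)
          ≡⟨ sum-cong-≗ (λ u → ∑-comm (λ v u′ → term v u u′)) ⟩
        ∑[ u < n ] ∑[ u′ < n ] ∑[ v < n ] (term v u u′)
          ≡⟨ sum-cong-≗ (λ u → sum-cong-≗ (λ u′ →
               trans (sum-cong-≗ (λ v → regroup ⟦ T u ⟧ ⟦ T u′ ⟧ (A u v) (A u′ v)))
                     (∑-*ˡ (⟦ T u ⟧ * ⟦ T u′ ⟧) (λ v → A u v * A u′ v)))) ⟩
        ∑[ u < n ] ∑[ u′ < n ] ((⟦ T u ⟧ * ⟦ T u′ ⟧) * A² u u′)
          ≡⟨ sum-cong-≗ (λ u → trans (sum-cong-≗ (λ u′ → ℤP.*-assoc ⟦ T u ⟧ ⟦ T u′ ⟧ (A² u u′)))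
                                     (∑-*ˡ ⟦ T u ⟧ (λ u′ → ⟦ T u′ ⟧ * A² u u′))) ⟩
        ∑[ u < n ] (⟦ T u ⟧ * ∑[ u′ < n ] (⟦ T u′ ⟧ * A² u u′)) ∎
        where
        open ≡-Reasoning
        term : Fin n → Fin n → Fin n → ℤ
        term v u u′ = (⟦ T u ⟧ * A u v) * (⟦ T u′ ⟧ * A u′ v)
        regroup : ∀ x y p q → (x * p) * (y * q) ≡ (x * y) * (p * q)
        regroup = solve-∀

      ∑-T-const : ∀ (f : Fin n → ℤ) c → (∀ v → T v ≡ true → f v ≡ c) → ∑[ v < n ] (⟦ T v ⟧ * f v) ≡ size * c
      ∑-T-const f c f≡c = trans (sum-cong-≗ pointwise) (∑-*ʳ c (λ v → ⟦ T v ⟧))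
        where
        pointwise : ∀ v → ⟦ T v ⟧ * f v ≡ ⟦ T v ⟧ * c
        pointwise v with T v in Tv
        ... | true  = cong (1ℤ *_) (f≡c v Tv)
        ... | false = refl

      ∑-T-punctured : ∀ (F : Fin n → ℤ) a u → T u ≡ true → (∀ u′ → T u′ ≡ true → u′ ≢ u → F u′ ≡ a) →
                      ∑[ u′ < n ] (⟦ T u′ ⟧ * F u′) ≡ size * a + (F u - a)
      ∑-T-punctured F a u Tu F≡a = begin
        ∑[ u′ < n ] (⟦ T u′ ⟧ * F u′)                         ≡⟨ sum-cong-≗ (λ u′ → pointwise u′ (u′ ≟ u)) ⟩
        ∑[ u′ < n ] (⟦ T u′ ⟧ * a + δ u′ u * (F u - a))       ≡⟨ ∑-distrib-+ (λ u′ → ⟦ T u′ ⟧ * a) (λ u′ → δ u′ u * (F u - a)) ⟩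
        ∑[ u′ < n ] (⟦ T u′ ⟧ * a) + ∑[ u′ < n ] (δ u′ u * (F u - a))
          ≡⟨ cong₂ _+_ (∑-*ʳ a (λ u′ → ⟦ T u′ ⟧)) (∑-δ u (λ _ → F u - a)) ⟩
        size * a + (F u - a)                                  ∎
        where
        open ≡-Reasoning
        split : ∀ x a → 1ℤ * x ≡ 1ℤ * a + 1ℤ * (x - a)
        split = solve-∀
        pointwise : ∀ u′ → Dec (u′ ≡ u) → ⟦ T u′ ⟧ * F u′ ≡ ⟦ T u′ ⟧ * a + δ u′ u * (F u - a)
        pointwise u′ (yes refl) rewrite Tu | δ-refl u = split (F u) a
        pointwise u′ (no u′≢u) rewrite δ-≢ u′≢u with T u′ in Tu′
        ... | true  = trans (cong (1ℤ *_) (F≡a u′ Tu′ u′≢u)) (sym (ℤP.+-identityʳ (1ℤ * a)))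
        ... | false = refl

      module Homogeneous (b : Bool) (T-adj : ∀ u v → T u ≡ true → T v ≡ true → u ≢ v → adj G u v ≡ b) where

        a ρ : ℤ
        a = ⟦ b ⟧
        ρ = + commonNeighbourCount b

        neighboursIn-T : ∀ v → T v ≡ true → neighboursIn v ≡ (size - 1ℤ) * a
        neighboursIn-T v Tv = begin
          neighboursIn v          ≡⟨ ∑-T-punctured (λ u → A u v) a v Tv (λ u Tu u≢v → cong ⟦_⟧ (T-adj u v Tu Tv u≢v)) ⟩
          size * a + (A v v - a)  ≡⟨ cong (λ x → size * a + (x - a)) (A-diag v) ⟩
          size * a + (0ℤ - a)     ≡⟨ collect size a ⟩
          (size - 1ℤ) * a         ∎
          where
          open ≡-Reasoning
          collect : ∀ c a → c * a + (0ℤ - a) ≡ (c - 1ℤ) * a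
          collect = solve-∀

        codegree-T : ∀ u → T u ≡ true → ∑[ u′ < n ] (⟦ T u′ ⟧ * A² u u′) ≡ size * ρ + (+ k - ρ)
        codegree-T u Tu = trans
          (∑-T-punctured (A² u) ρ u Tu (λ u′ Tu′ u′≢u → A²-offDiag (≢-sym u′≢u) (T-adj u u′ Tu Tu′ (≢-sym u′≢u))))
          (cong (λ x → size * ρ + (x - ρ)) (A²-diag u))

        outside : Fin n → ℤ
        outside v = 1ℤ - ⟦ T v ⟧

        ∑-outside : sum outside ≡ + n - size
        ∑-outside = trans (∑-distrib-- (λ _ → 1ℤ) (λ v → ⟦ T v ⟧)) (cong (_- size) ∑-one)

        ∑-outside-restrict : ∀ (f : Fin n → ℤ) → ∑[ v < n ] (outside v * f v) ≡ sum f - ∑[ v < n ] (⟦ T v ⟧ * f v)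
        ∑-outside-restrict f = trans (sum-cong-≗ (λ v → distrib ⟦ T v ⟧ (f v))) (∑-distrib-- f (λ v → ⟦ T v ⟧ * f v))
          where
          distrib : ∀ t x → (1ℤ - t) * x ≡ x - t * x
          distrib = solve-∀

        firstMoment : ∑[ v < n ] (outside v * neighboursIn v) ≡ size * + k - size * ((size - 1ℤ) * a)
        firstMoment = trans (∑-outside-restrict neighboursIn)
          (cong₂ _-_ ∑-neighboursIn (∑-T-const neighboursIn ((size - 1ℤ) * a) neighboursIn-T))

        secondMoment : ∑[ v < n ] (outside v * neighboursIn v * neighboursIn v)
                     ≡ size * (size * ρ + (+ k - ρ)) - size * (((size - 1ℤ) * a) * ((size - 1ℤ) * a))
        secondMoment = trans (sum-cong-≗ (λ v → ℤP.*-assoc (outside v) (neighboursIn v) (neighboursIn v)))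
          (trans (∑-outside-restrict (λ v → neighboursIn v * neighboursIn v))
            (cong₂ _-_ (trans ∑-neighboursIn² (∑-T-const _ (size * ρ + (+ k - ρ)) codegree-T))
                       (∑-T-const (λ v → neighboursIn v * neighboursIn v) (((size - 1ℤ) * a) * ((size - 1ℤ) * a))
                          (λ v Tv → cong₂ _*_ (neighboursIn-T v Tv) (neighboursIn-T v Tv)))))

        outside-nonNeg : ∀ v → 0ℤ ≤ outside v
        outside-nonNeg v with T v
        ... | true  = +≤+ ℕ.z≤n
        ... | false = +≤+ ℕ.z≤n

        -- Cauchy–Schwarz for the numbers of T-neighbours of the vertices outside T.
        homogeneousInequality :
          (size * + k - size * ((size - 1ℤ) * a)) * (size * + k - size * ((size - 1ℤ) * a))
          ≤ (+ n - size) * (size * (size * ρ + (+ k - ρ)) - size * (((size - 1ℤ) * a) * ((size - 1ℤ) * a)))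
        homogeneousInequality = subst₂ _≤_ (cong₂ _*_ firstMoment firstMoment) (cong₂ _*_ ∑-outside secondMoment)
          (cauchy-schwarz outside neighboursIn outside-nonNeg)

    size≡count : ∀ T → VertexSet.size T ≡ + count T
    size≡count T = sym (count≡∑ T)

    hoffmanBound : ∀ T → IsCoclique G T → 0ℤ < + count T → 0ℤ ≤ hoffmanPoly (+ n) (+ k) (+ μ) (+ count T)
    hoffmanBound T coclique c>0 = *-cancelˡ-nonNeg c>0 (subst (λ c → 0ℤ ≤ c * hoffmanPoly (+ n) (+ k) (+ μ) c) (size≡count T)
      (subst (0ℤ ≤_) (identity (+ n) (+ k) (+ μ) (VertexSet.size T)) (ℤP.i≤j⇒0≤j-i homogeneousInequality)))
      where
      open VertexSet.Homogeneous T false (λ u v Tu Tv _ → coclique u v Tu Tv)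
      identity : ∀ ν k μ c → (ν - c) * (c * (c * μ + (k - μ)) - c * (((c - 1ℤ) * 0ℤ) * ((c - 1ℤ) * 0ℤ)))
                             - (c * k - c * ((c - 1ℤ) * 0ℤ)) * (c * k - c * ((c - 1ℤ) * 0ℤ))
                             ≡ c * ((ν - c) * (c * μ + (k - μ)) - c * k * k)
      identity = solve-∀

    delsarteBound : InducedPath₂ G → ∀ T → IsClique G T → 0ℤ < + count T → 0ℤ ≤ delsartePoly (+ k) (+ l) (+ μ) (+ count T)
    delsarteBound P T clique c>0 = *-cancelˡ-nonNeg (*-pos (k-λ-1>0 P) c>0)
      (subst (λ c → 0ℤ ≤ (+ k - + l - 1ℤ) * c * delsartePoly (+ k) (+ l) (+ μ) c) (size≡count T)
        (subst (0ℤ ≤_) μ·gap≡ (*-nonNeg (ℤP.<⇒≤ (μ>0 P)) (ℤP.i≤j⇒0≤j-i homogeneousInequality))))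
      where
      open VertexSet.Homogeneous T true clique
      c = VertexSet.size T
      Y : ℤ
      Y = c * (c * + l + (+ k - + l)) - c * (((c - 1ℤ) * 1ℤ) * ((c - 1ℤ) * 1ℤ))
      identity : ∀ k l μ ν c →
        μ * ((ν - c) * (c * (c * l + (k - l)) - c * (((c - 1ℤ) * 1ℤ) * ((c - 1ℤ) * 1ℤ)))
             - (c * k - c * ((c - 1ℤ) * 1ℤ)) * (c * k - c * ((c - 1ℤ) * 1ℤ)))
        ≡ (k - l - 1ℤ) * c * (k * k + (l - μ) * k * (c - 1ℤ) - (k - μ) * (c - 1ℤ) * (c - 1ℤ))
          + (c * (c * l + (k - l)) - c * (((c - 1ℤ) * 1ℤ) * ((c - 1ℤ) * 1ℤ))) * ((ν - k - 1ℤ) * μ - k * (k - l - 1ℤ))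
      identity = solve-∀
      μ·gap≡ : + μ * ((+ n - c) * Y - (c * + k - c * ((c - 1ℤ) * 1ℤ)) * (c * + k - c * ((c - 1ℤ) * 1ℤ)))
               ≡ (+ k - + l - 1ℤ) * c * delsartePoly (+ k) (+ l) (+ μ) c
      μ·gap≡ = begin
        _ ≡⟨ identity (+ k) (+ l) (+ μ) (+ n) c ⟩
        (+ k - + l - 1ℤ) * c * delsartePoly (+ k) (+ l) (+ μ) c + Y * ((+ n - + k - 1ℤ) * + μ - + k * (+ k - + l - 1ℤ))
          ≡⟨ cong (λ r → (+ k - + l - 1ℤ) * c * delsartePoly (+ k) (+ l) (+ μ) c + Y * r) (ℤP.i≡j⇒i-j≡0 (parameterRelation (InducedPath₂.p P))) ⟩
        (+ k - + l - 1ℤ) * c * delsartePoly (+ k) (+ l) (+ μ) c + Y * 0ℤ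
          ≡⟨ trans (cong (λ t → (+ k - + l - 1ℤ) * c * delsartePoly (+ k) (+ l) (+ μ) c + t) (ℤP.*-zeroʳ Y)) (ℤP.+-identityʳ _) ⟩
        (+ k - + l - 1ℤ) * c * delsartePoly (+ k) (+ l) (+ μ) c ∎
        where open ≡-Reasoning

module Quadratic where

  open import Data.Nat as ℕ using (ℕ)
  open import Data.Integer using (ℤ; +_; 0ℤ; 1ℤ; _+_; _*_; _-_; -_; _≤_; _<_; +≤+; +<+)
  import Data.Integer.Properties as ℤP
  open import Data.Product using (_×_; _,_)
  open import Data.Empty using (⊥-elim)
  open import Data.Sum using (inj₁; inj₂)
  open import Function.Bundles using (_⇔_; mk⇔)
  open import Relation.Nullary using (yes; no)
  open import Relation.Binary.PropositionalEquality
  open import Data.Integer.Tactic.RingSolver using (solve-∀)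
  open Integers
  open StronglyRegular using (delsartePoly; hoffmanPoly)

  -- A monic quadratic with f(0) = -C ≤ 0 has exactly one positive root, which
  -- separates the positive points where f is ≥ 0 from those where it is ≤ 0.
  module MonicQuadratic (b C : ℤ) (C≥0 : 0ℤ ≤ C) where

    f : ℤ → ℤ
    f t = t * t + b * t - C

    private
      f-difference : ∀ p q → f q - f p ≡ (q - p) * (q + p + b)
      f-difference p q = lemma p q b C
        where
        lemma : ∀ p q b C → (q * q + b * q - C) - (p * p + b * p - C) ≡ (q - p) * (q + p + b)
        lemma = solve-∀

      -- otherwise f p = p (q + p + b) - p q - C < 0
      q+p+b>0 : ∀ {p q} → 0ℤ < p → 0ℤ < q → 0ℤ ≤ f p → 0ℤ < q + p + b
      q+p+b>0 {p} {q} p>0 q>0 fp≥0 with 0ℤ ℤP.<? q + p + b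
      ... | yes s>0 = s>0
      ... | no  s≯0 = ⊥-elim (ℤP.<-irrefl refl (ℤP.≤-<-trans fp≥0 fp<0))
        where
        S : ℤ
        S = - (q + p + b)
        S≥0 : 0ℤ ≤ S
        S≥0 = ℤP.neg-mono-≤ (ℤP.≮⇒≥ s≯0)
        fp-rearranged : ∀ p q b C → - (p * q + (p * - (q + p + b) + C)) ≡ p * p + b * p - C
        fp-rearranged = solve-∀
        fp<0 : f p < 0ℤ
        fp<0 = subst (_< 0ℤ) (fp-rearranged p q b C)
          (ℤP.neg-mono-< (ℤP.+-mono-<-≤ (*-pos p>0 q>0) (ℤP.+-mono-≤ (*-nonNeg (ℤP.<⇒≤ p>0) S≥0) C≥0)))

    root-separates : ∀ {p q} → 0ℤ < p → 0ℤ < q → 0ℤ ≤ f p → f q ≤ 0ℤ → q ≤ p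
    root-separates {p} {q} p>0 q>0 fp≥0 fq≤0 with p ℤP.<? q
    ... | no  p≮q = ℤP.≮⇒≥ p≮q
    ... | yes p<q = ⊥-elim (ℤP.<-irrefl refl (ℤP.<-≤-trans difference>0 difference≤0))
      where
      difference>0 : 0ℤ < f q - f p
      difference>0 = subst (0ℤ <_) (sym (f-difference p q))
        (*-pos (i<j⇒0<j-i p<q) (q+p+b>0 p>0 q>0 fp≥0))
      difference≤0 : f q - f p ≤ 0ℤ
      difference≤0 = ℤP.i≤j⇒i-j≤0 (ℤP.≤-trans fq≤0 fp≥0)

    roots-coincide : ∀ {p q} → 0ℤ < p → 0ℤ < q → f p ≡ 0ℤ → f q ≡ 0ℤ → q ≡ p
    roots-coincide {p} {q} p>0 q>0 fp≡0 fq≡0 = ℤP.i-j≡0⇒i≡j _ _ (*-cancelʳ-zero (q+p+b>0 p>0 q>0 (ℤP.≤-reflexive (sym fp≡0)))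
      (trans (sym (f-difference p q)) (cong₂ _-_ fq≡0 fp≡0)))

  -- At p = k z and q = α k x the quadratic
  -- t² + (λ-μ) x z t - (k-μ) x² z² takes the values z²·delsartePoly and -x²·ν·hoffmanPoly,
  -- so the two bounds give q ≤ p, i.e. α (ω - 1) ≤ ν - α.
  module ProductBound (k l μ ν ω α : ℕ)
    (k>0 : 0ℤ < + k) (μ≤k : + μ ≤ + k) (ω≥2 : 2 ℕ.≤ ω) (α≥1 : 1 ℕ.≤ α) (α≤ν : α ℕ.≤ ν)
    (relation : (+ ν - + k - 1ℤ) * + μ ≡ + k * (+ k - + l - 1ℤ))
    (delsarte≥0 : 0ℤ ≤ delsartePoly (+ k) (+ l) (+ μ) (+ ω))
    (hoffman≥0 : 0ℤ ≤ hoffmanPoly (+ ν) (+ k) (+ μ) (+ α)) where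

    private
      d K x z e p q G h H : ℤ
      d = + l - + μ
      K = + k - + μ
      x = + ω - 1ℤ
      z = + ν - + α
      e = x * z
      p = + k * z
      q = + α * + k * x
      G = delsartePoly (+ k) (+ l) (+ μ) (+ ω)
      h = hoffmanPoly (+ ν) (+ k) (+ μ) (+ α)
      H = K * z * z - + α * + α * + k * + k - d * + α * + k * z

      K≥0 : 0ℤ ≤ K
      K≥0 = ℤP.i≤j⇒0≤j-i μ≤k

      open MonicQuadratic (d * e) (K * (e * e)) (*-nonNeg K≥0 (square-nonNeg e))

      f-p : f p ≡ z * z * G
      f-p = lemma (+ k) d K x z
        where
        lemma : ∀ k d K x z → (k * z) * (k * z) + d * (x * z) * (k * z) - K * ((x * z) * (x * z))
                              ≡ z * z * (k * k + d * k * x - K * x * x)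
        lemma = solve-∀

      f-q : f q ≡ - (x * x * H)
      f-q = lemma (+ k) d K x z (+ α)
        where
        lemma : ∀ k d K x z a → (a * k * x) * (a * k * x) + d * (x * z) * (a * k * x) - K * ((x * z) * (x * z))
                                ≡ - (x * x * (K * z * z - a * a * k * k - d * a * k * z))
        lemma = solve-∀

      H≡νh : H ≡ + ν * h
      H≡νh = begin
        H                                   ≡⟨ lemma (+ k) (+ l) (+ μ) (+ ν) (+ α) ⟩
        + ν * h - + α * z * R               ≡⟨ cong (λ r → + ν * h - + α * z * r) (ℤP.i≡j⇒i-j≡0 relation) ⟩
        + ν * h - + α * z * 0ℤ              ≡⟨ cong (λ t → + ν * h - t) (ℤP.*-zeroʳ (+ α * z)) ⟩
        + ν * h - 0ℤ                        ≡⟨ ℤP.+-identityʳ (+ ν * h) ⟩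
        + ν * h                             ∎
        where
        open ≡-Reasoning
        R : ℤ
        R = (+ ν - + k - 1ℤ) * + μ - + k * (+ k - + l - 1ℤ)
        lemma : ∀ k l μ ν a → (k - μ) * (ν - a) * (ν - a) - a * a * k * k - (l - μ) * a * k * (ν - a)
                              ≡ ν * ((ν - a) * (a * μ + (k - μ)) - a * k * k) - a * (ν - a) * ((ν - k - 1ℤ) * μ - k * (k - l - 1ℤ))
        lemma = solve-∀

      H≥0 : 0ℤ ≤ H
      H≥0 = subst (0ℤ ≤_) (sym H≡νh) (*-nonNeg {+ ν} (+≤+ ℕ.z≤n) hoffman≥0)

      α>0 : 0ℤ < + α
      α>0 = +<+ α≥1

      x>0 : 0ℤ < x
      x>0 = i<j⇒0<j-i (+<+ ω≥2)

      z>0 : 0ℤ < z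
      z>0 with nonNeg-zero⊎pos (ℤP.i≤j⇒0≤j-i (+≤+ α≤ν))
      ... | inj₂ z>0 = z>0
      ... | inj₁ z≡0 = ⊥-elim (ℤP.<-irrefl refl (ℤP.≤-<-trans H≥0 (subst (_< 0ℤ) (sym H-at-0) (ℤP.neg-mono-< (*-pos αk>0 αk>0)))))
        where
        αk>0 : 0ℤ < + α * + k
        αk>0 = *-pos α>0 k>0
        lemma : ∀ K a k d → K * 0ℤ * 0ℤ - a * a * k * k - d * a * k * 0ℤ ≡ - (a * k * (a * k))
        lemma = solve-∀
        H-at-0 : H ≡ - (+ α * + k * (+ α * + k))
        H-at-0 = trans (cong (λ z → K * z * z - + α * + α * + k * + k - d * + α * + k * z) z≡0) (lemma K (+ α) (+ k) d)

      p>0 : 0ℤ < p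
      p>0 = *-pos k>0 z>0

      q>0 : 0ℤ < q
      q>0 = *-pos (*-pos α>0 k>0) x>0

      f-p≥0 : 0ℤ ≤ f p
      f-p≥0 = subst (0ℤ ≤_) (sym f-p) (*-nonNeg (square-nonNeg z) delsarte≥0)

      f-q≤0 : f q ≤ 0ℤ
      f-q≤0 = subst (_≤ 0ℤ) (sym f-q) (ℤP.neg-mono-≤ (*-nonNeg (square-nonNeg x) H≥0))

      p-q≡k[ν-ωα] : p - q ≡ + k * (+ ν - + ω * + α)
      p-q≡k[ν-ωα] = lemma (+ k) (+ ν) (+ α) (+ ω)
        where
        lemma : ∀ k ν a w → k * (ν - a) - a * k * (w - 1ℤ) ≡ k * (ν - w * a)
        lemma = solve-∀

      ωα-as-ℤ : + (ω ℕ.* α) ≡ + ω * + α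
      ωα-as-ℤ = ℤP.pos-* ω α

    ωα≤ν : ω ℕ.* α ℕ.≤ ν
    ωα≤ν = ℤP.drop‿+≤+ (subst (_≤ + ν) (sym ωα-as-ℤ) (ℤP.0≤i-j⇒j≤i
      (*-cancelˡ-nonNeg k>0 (subst (0ℤ ≤_) p-q≡k[ν-ωα] (ℤP.i≤j⇒0≤j-i (root-separates p>0 q>0 f-p≥0 f-q≤0))))))

    ωα≡ν⇔bounds-tight : (ω ℕ.* α ≡ ν) ⇔ (G ≡ 0ℤ × h ≡ 0ℤ)
    ωα≡ν⇔bounds-tight = mk⇔ tight equal
      where
      zero-product : ∀ {i j} → 0ℤ < i → i * i * j ≡ 0ℤ → j ≡ 0ℤ
      zero-product i>0 = *-cancelˡ-zero (*-pos i>0 i>0)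

      tight : ω ℕ.* α ≡ ν → G ≡ 0ℤ × h ≡ 0ℤ
      tight ωα≡ν = zero-product z>0 (trans (sym f-p) fp≡0) , h≡0
        where
        p≡q : p ≡ q
        p≡q = ℤP.i-j≡0⇒i≡j _ _ (trans p-q≡k[ν-ωα] (trans (cong (+ k *_) (ℤP.i≡j⇒i-j≡0 (trans (cong +_ (sym ωα≡ν)) ωα-as-ℤ)))
                                                     (ℤP.*-zeroʳ (+ k))))
        fp≡0 : f p ≡ 0ℤ
        fp≡0 = ℤP.≤-antisym (subst (λ t → f t ≤ 0ℤ) (sym p≡q) f-q≤0) f-p≥0
        H≡0 : H ≡ 0ℤ
        H≡0 = zero-product x>0 (ℤP.neg-injective (trans (sym f-q) (trans (cong f (sym p≡q)) fp≡0)))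
        h≡0 : h ≡ 0ℤ
        h≡0 = *-cancelˡ-zero (ℤP.<-≤-trans α>0 (+≤+ α≤ν)) (trans (sym H≡νh) H≡0)

      equal : G ≡ 0ℤ × h ≡ 0ℤ → ω ℕ.* α ≡ ν
      equal (G≡0 , h≡0) = ℤP.+-injective (trans ωα-as-ℤ (sym (ℤP.i-j≡0⇒i≡j _ _ ν-ωα≡0)))
        where
        fp≡0 : f p ≡ 0ℤ
        fp≡0 = trans f-p (trans (cong (z * z *_) G≡0) (ℤP.*-zeroʳ (z * z)))
        fq≡0 : f q ≡ 0ℤ
        fq≡0 = trans f-q (cong -_ (trans (cong (x * x *_) (trans H≡νh (trans (cong (+ ν *_) h≡0) (ℤP.*-zeroʳ (+ ν)))))
                                         (ℤP.*-zeroʳ (x * x))))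
        ν-ωα≡0 : + ν - + ω * + α ≡ 0ℤ
        ν-ωα≡0 = *-cancelˡ-zero k>0 (trans (sym p-q≡k[ν-ωα]) (ℤP.i≡j⇒i-j≡0 (sym (roots-coincide p>0 q>0 fp≡0 fq≡0))))

module Surds where

  open import Data.Nat as ℕ using (zero)
  open import Data.Integer as ℤ using (ℤ; +_; -[1+_]; +[1+_]; 0ℤ; -≤+; +≤+)
  import Data.Integer.Properties as ℤP
  open import Data.Rational.Base as ℚ using (ℚ; 0ℚ; mkℚ)
  import Data.Rational.Properties as ℚP
  open import Data.Rational.Unnormalised.Base as ℚᵘ using (mkℚᵘ; *≡*)
  import Data.Rational.Unnormalised.Properties as ℚᵘP
  open import Data.Nat.Coprimality as Coprimality using (1-coprimeTo)
  open import Data.Product using (_×_; _,_)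
  open import Data.Empty using (⊥-elim)
  open import Function.Bundles using (_⇔_; mk⇔; Equivalence)
  open import Relation.Nullary using (yes; no)
  open import Relation.Binary.Definitions using (tri<; tri≈; tri>)
  open import Relation.Binary.PropositionalEquality
  open import Data.Integer.Tactic.RingSolver using (solve-∀)
  import Data.Rational.Solver
  open Data.Rational.Solver.+-*-Solver using (solve; _:*_; _:-_; _:=_)
  open import Defs using (Surd; ⟨_,_⟩; module SurdOps)
  open Integers

  ι : ℤ → ℚ
  ι z = z ℚ./ 1

  private
    ι≡mkℚ : ∀ z → ι z ≡ mkℚ z 0 (Coprimality.sym (1-coprimeTo _))
    ι≡mkℚ z = ℚP.↥p/↧p≡p (mkℚ z 0 _)

    ι-mkℚ : ∀ z → ℚ.toℚᵘ (ι z) ≡ mkℚᵘ z 0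
    ι-mkℚ z = cong ℚ.toℚᵘ (ι≡mkℚ z)

    via-ℚᵘ : ∀ {x y} → ℚ.toℚᵘ x ℚᵘ.≃ ℚ.toℚᵘ y → x ≡ y
    via-ℚᵘ = ℚP.toℚᵘ-injective

  ι-+ : ∀ a b → ι (a ℤ.+ b) ≡ ι a ℚ.+ ι b
  ι-+ a b = via-ℚᵘ (ℚᵘP.≃-trans (ℚᵘP.≃-reflexive (ι-mkℚ (a ℤ.+ b)))
    (ℚᵘP.≃-trans (*≡* (lemma a b)) (ℚᵘP.≃-sym (ℚᵘP.≃-trans (ℚP.toℚᵘ-homo-+ (ι a) (ι b))
       (ℚᵘP.≃-reflexive (cong₂ ℚᵘ._+_ (ι-mkℚ a) (ι-mkℚ b)))))))
    where
    lemma : ∀ a b → (a ℤ.+ b) ℤ.* + 1 ≡ (a ℤ.* + 1 ℤ.+ b ℤ.* + 1) ℤ.* + 1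
    lemma = solve-∀

  ι-* : ∀ a b → ι (a ℤ.* b) ≡ ι a ℚ.* ι b
  ι-* a b = via-ℚᵘ (ℚᵘP.≃-trans (ℚᵘP.≃-reflexive (ι-mkℚ (a ℤ.* b)))
    (ℚᵘP.≃-trans (*≡* (lemma a b)) (ℚᵘP.≃-sym (ℚᵘP.≃-trans (ℚP.toℚᵘ-homo-* (ι a) (ι b))
       (ℚᵘP.≃-reflexive (cong₂ ℚᵘ._*_ (ι-mkℚ a) (ι-mkℚ b)))))))
    where
    lemma : ∀ a b → (a ℤ.* b) ℤ.* + 1 ≡ (a ℤ.* b) ℤ.* (+ 1 ℤ.* + 1)
    lemma = solve-∀

  ι-neg : ∀ a → ι (ℤ.- a) ≡ ℚ.- ι a
  ι-neg a = via-ℚᵘ (ℚᵘP.≃-trans (ℚᵘP.≃-reflexive (ι-mkℚ (ℤ.- a)))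
    (ℚᵘP.≃-sym (ℚᵘP.≃-trans (ℚP.toℚᵘ-homo‿- (ι a)) (ℚᵘP.≃-reflexive (cong ℚᵘ.-_ (ι-mkℚ a))))))

  ι-- : ∀ a b → ι (a ℤ.- b) ≡ ι a ℚ.- ι b
  ι-- a b = trans (ι-+ a (ℤ.- b)) (cong (ι a ℚ.+_) (ι-neg b))

  ι-positive : ∀ {z} → 0ℤ ℤ.< z → 0ℚ ℚ.< ι z
  ι-positive {z} z>0 = subst (0ℚ ℚ.<_) (sym (ι≡mkℚ z))
    (ℚ.*<* (subst (0ℤ ℤ.<_) (sym (ℤP.*-identityʳ z)) z>0))

  ι-negative : ∀ {z} → z ℤ.< 0ℤ → ι z ℚ.< 0ℚ
  ι-negative {z} z<0 = subst (ℚ._< 0ℚ) (sym (ι≡mkℚ z))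
    (ℚ.*<* (subst (ℤ._< 0ℤ) (sym (ℤP.*-identityʳ z)) z<0))

  record ScaledIntegral (x : Surd) : Set where
    field
      scale   : ℚ
      A B     : ℤ
      scale>0 : 0ℚ ℚ.< scale
      x≡      : x ≡ ⟨ scale ℚ.* ι A , scale ℚ.* ι B ⟩

  module SurdSign (D : ℤ) (D≢0 : D ≢ 0ℤ) where

    open SurdOps D

    sgZ : ℤ → Sign
    sgZ -[1+ _ ] = neg
    sgZ (+ zero) = zer
    sgZ +[1+ _ ] = pos

    sgZ-zer⁻¹ : ∀ z → sgZ z ≡ zer → z ≡ 0ℤ
    sgZ-zer⁻¹ (+ zero) _ = refl

    private
      signQ-zer : ∀ x → x ≡ 0ℚ → signQ x ≡ zer
      signQ-zer x x≡0 with x ℚP.≟ 0ℚ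
      ... | yes _   = refl
      ... | no x≢0 = ⊥-elim (x≢0 x≡0)

      signQ-neg : ∀ x → x ℚ.< 0ℚ → signQ x ≡ neg
      signQ-neg x x<0 with x ℚP.≟ 0ℚ
      ... | yes x≡0 = ⊥-elim (ℚP.<-irrefl x≡0 x<0)
      ... | no _ with x ℚP.<? 0ℚ
      ...   | yes _   = refl
      ...   | no x≮0 = ⊥-elim (x≮0 x<0)

      signQ-pos : ∀ x → 0ℚ ℚ.< x → signQ x ≡ pos
      signQ-pos x x>0 with x ℚP.≟ 0ℚ
      ... | yes x≡0 = ⊥-elim (ℚP.<-irrefl (sym x≡0) x>0)
      ... | no _ with x ℚP.<? 0ℚ
      ...   | yes x<0 = ⊥-elim (ℚP.<-asym x<0 x>0)
      ...   | no _    = refl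

      signQ-ι : ∀ z → signQ (ι z) ≡ sgZ z
      signQ-ι -[1+ n ] = signQ-neg _ (ι-negative { -[1+ n ]} ℤ.-<+)
      signQ-ι (+ zero) = signQ-zer _ refl
      signQ-ι +[1+ n ] = signQ-pos _ (ι-positive {+[1+ n ]} (ℤ.+<+ (ℕ.s≤s ℕ.z≤n)))

      signQ-*-pos : ∀ q x → 0ℚ ℚ.< q → signQ (q ℚ.* x) ≡ signQ x
      signQ-*-pos q x q>0 with ℚP.<-cmp x 0ℚ
      ... | tri< x<0 _ _ = trans (signQ-neg _ (subst (q ℚ.* x ℚ.<_) (ℚP.*-zeroʳ q) (ℚP.*-monoʳ-<-pos q x<0))) (sym (signQ-neg x x<0))
        where instance _ = ℚ.positive q>0
      ... | tri≈ _ x≡0 _ = trans (signQ-zer _ (trans (cong (q ℚ.*_) x≡0) (ℚP.*-zeroʳ q))) (sym (signQ-zer x x≡0))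
      ... | tri> _ _ x>0 = trans (signQ-pos _ (subst (ℚ._< q ℚ.* x) (ℚP.*-zeroʳ q) (ℚP.*-monoʳ-<-pos q x>0))) (sym (signQ-pos x x>0))
        where instance _ = ℚ.positive q>0

    -- The case analysis of signS, with the branch D = 0 excluded.
    combine : Sign → Sign → Sign → Sign → Sign
    combine neg neg _  _  = neg
    combine neg zer _  _  = neg
    combine neg pos _  s₂ = s₂
    combine zer neg _  _  = neg
    combine zer zer _  _  = zer
    combine zer pos _  _  = pos
    combine pos neg s₁ _  = s₁
    combine pos zer _  _  = pos
    combine pos pos _  _  = pos

    signS-combine : ∀ a b → signS ⟨ a , b ⟩ ≡
      combine (signQ a) (signQ b) (signQ (a ℚ.* a ℚ.- b ℚ.* b ℚ.* Dq)) (signQ (b ℚ.* b ℚ.* Dq ℚ.- a ℚ.* a))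
    signS-combine a b with D ℤ.≟ 0ℤ | signQ a | signQ b
    ... | yes D≡0 | _   | _   = ⊥-elim (D≢0 D≡0)
    ... | no _    | neg | neg = refl
    ... | no _    | neg | zer = refl
    ... | no _    | neg | pos = refl
    ... | no _    | zer | neg = refl
    ... | no _    | zer | zer = refl
    ... | no _    | zer | pos = refl
    ... | no _    | pos | neg = refl
    ... | no _    | pos | zer = refl
    ... | no _    | pos | pos = refl

    signS-scaled : ∀ q A B → 0ℚ ℚ.< q → signS ⟨ q ℚ.* ι A , q ℚ.* ι B ⟩ ≡
      combine (sgZ A) (sgZ B) (sgZ (A ℤ.* A ℤ.- B ℤ.* B ℤ.* D)) (sgZ (B ℤ.* B ℤ.* D ℤ.- A ℤ.* A))
    signS-scaled q A B q>0 = trans (signS-combine (q ℚ.* ι A) (q ℚ.* ι B))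
      (cong₄ combine (trans (signQ-*-pos q (ι A) q>0) (signQ-ι A)) (trans (signQ-*-pos q (ι B) q>0) (signQ-ι B))
        (trans (cong signQ (scale₁ q (ι A) (ι B) Dq)) (trans (signQ-*-pos (q ℚ.* q) _ q²>0) (trans (cong signQ ι-norm₁) (signQ-ι _))))
        (trans (cong signQ (scale₂ q (ι A) (ι B) Dq)) (trans (signQ-*-pos (q ℚ.* q) _ q²>0) (trans (cong signQ ι-norm₂) (signQ-ι _)))))
      where
      cong₄ : ∀ {A B C E F : Set} (f : A → B → C → E → F) {a a' b b' c c' e e'} →
              a ≡ a' → b ≡ b' → c ≡ c' → e ≡ e' → f a b c e ≡ f a' b' c' e'
      cong₄ f refl refl refl refl = refl
      q²>0 : 0ℚ ℚ.< q ℚ.* q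
      q²>0 = subst (ℚ._< q ℚ.* q) (ℚP.*-zeroʳ q) (ℚP.*-monoʳ-<-pos q q>0)
        where instance _ = ℚ.positive q>0
      scale₁ : ∀ q a b d → (q ℚ.* a) ℚ.* (q ℚ.* a) ℚ.- (q ℚ.* b) ℚ.* (q ℚ.* b) ℚ.* d ≡ (q ℚ.* q) ℚ.* (a ℚ.* a ℚ.- b ℚ.* b ℚ.* d)
      scale₁ = solve 4 (λ q a b d → (q :* a) :* (q :* a) :- (q :* b) :* (q :* b) :* d := (q :* q) :* (a :* a :- b :* b :* d)) refl
      scale₂ : ∀ q a b d → (q ℚ.* b) ℚ.* (q ℚ.* b) ℚ.* d ℚ.- (q ℚ.* a) ℚ.* (q ℚ.* a) ≡ (q ℚ.* q) ℚ.* (b ℚ.* b ℚ.* d ℚ.- a ℚ.* a)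
      scale₂ = solve 4 (λ q a b d → (q :* b) :* (q :* b) :* d :- (q :* a) :* (q :* a) := (q :* q) :* (b :* b :* d :- a :* a)) refl
      ι-norm₁ : ι A ℚ.* ι A ℚ.- ι B ℚ.* ι B ℚ.* Dq ≡ ι (A ℤ.* A ℤ.- B ℤ.* B ℤ.* D)
      ι-norm₁ = sym (trans (ι-- (A ℤ.* A) (B ℤ.* B ℤ.* D)) (cong₂ ℚ._-_ (ι-* A A) (trans (ι-* (B ℤ.* B) D) (cong (ℚ._* Dq) (ι-* B B)))))
      ι-norm₂ : ι B ℚ.* ι B ℚ.* Dq ℚ.- ι A ℚ.* ι A ≡ ι (B ℤ.* B ℤ.* D ℤ.- A ℤ.* A)
      ι-norm₂ = sym (trans (ι-- (B ℤ.* B ℤ.* D) (A ℤ.* A)) (cong₂ ℚ._-_ (trans (ι-* (B ℤ.* B) D) (cong (ℚ._* Dq) (ι-* B B))) (ι-* A A)))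

    -- A + B√D = 0 (D ≠ 0) iff A and B have opposite signs (or vanish) and A² = B²D.
    Vanishes : ℤ → ℤ → Set
    Vanishes A B = A ℤ.* B ℤ.≤ 0ℤ × A ℤ.* A ≡ B ℤ.* B ℤ.* D

    combine-zer⇔ : ∀ A B →
      combine (sgZ A) (sgZ B) (sgZ (A ℤ.* A ℤ.- B ℤ.* B ℤ.* D)) (sgZ (B ℤ.* B ℤ.* D ℤ.- A ℤ.* A)) ≡ zer ⇔ Vanishes A B
    combine-zer⇔ A B = mk⇔ (to A B) (from A B)
      where
      to : ∀ A B → combine (sgZ A) (sgZ B) (sgZ (A ℤ.* A ℤ.- B ℤ.* B ℤ.* D)) (sgZ (B ℤ.* B ℤ.* D ℤ.- A ℤ.* A)) ≡ zer → Vanishes A B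
      to (+ zero)  (+ zero)  _ = +≤+ ℕ.z≤n , refl
      to -[1+ m ]  +[1+ n ]  e = -≤+ , sym (ℤP.i-j≡0⇒i≡j _ _ (sgZ-zer⁻¹ _ e))
      to +[1+ m ]  -[1+ n ]  e = -≤+ , ℤP.i-j≡0⇒i≡j _ _ (sgZ-zer⁻¹ _ e)
      to (+ zero)  +[1+ n ]  ()
      to (+ zero)  -[1+ n ]  ()
      to +[1+ m ]  (+ zero)  ()
      to -[1+ m ]  (+ zero)  ()
      to +[1+ m ]  +[1+ n ]  ()
      to -[1+ m ]  -[1+ n ]  ()
      D≡0 : ∀ B → 0ℤ ℤ.< B ℤ.* B → 0ℤ ≡ B ℤ.* B ℤ.* D → D ≡ 0ℤ
      D≡0 B B²>0 e = *-cancelˡ-zero B²>0 (sym e)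
      from : ∀ A B → Vanishes A B →
        combine (sgZ A) (sgZ B) (sgZ (A ℤ.* A ℤ.- B ℤ.* B ℤ.* D)) (sgZ (B ℤ.* B ℤ.* D ℤ.- A ℤ.* A)) ≡ zer
      from (+ zero)  (+ zero)  _ = refl
      from -[1+ m ]  +[1+ n ]  (_ , e) = cong sgZ (ℤP.i≡j⇒i-j≡0 (sym e))
      from +[1+ m ]  -[1+ n ]  (_ , e) = cong sgZ (ℤP.i≡j⇒i-j≡0 e)
      from (+ zero)  +[1+ n ]  (_ , e) = ⊥-elim (D≢0 (D≡0 +[1+ n ] (ℤ.+<+ (ℕ.s≤s ℕ.z≤n)) e))
      from (+ zero)  -[1+ n ]  (_ , e) = ⊥-elim (D≢0 (D≡0 -[1+ n ] (ℤ.+<+ (ℕ.s≤s ℕ.z≤n)) e))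
      from +[1+ m ]  (+ zero)  (_ , ())
      from -[1+ m ]  (+ zero)  (_ , ())
      from +[1+ m ]  +[1+ n ]  (+≤+ () , _)
      from -[1+ m ]  -[1+ n ]  (+≤+ () , _)

    signS-scaled-zer⇔ : ∀ q A B → 0ℚ ℚ.< q → signS ⟨ q ℚ.* ι A , q ℚ.* ι B ⟩ ≡ zer ⇔ Vanishes A B
    signS-scaled-zer⇔ q A B q>0 = mk⇔
      (λ e → Equivalence.to (combine-zer⇔ A B) (trans (sym (signS-scaled q A B q>0)) e))
      (λ v → trans (signS-scaled q A B q>0) (Equivalence.from (combine-zer⇔ A B) v))

    module _ {x : Surd} (rep : ScaledIntegral x) where
      open ScaledIntegral rep

      signS-zer⇔ : signS x ≡ zer ⇔ Vanishes A B
      signS-zer⇔ = subst (λ y → signS y ≡ zer ⇔ Vanishes A B) (sym x≡) (signS-scaled-zer⇔ scale A B scale>0)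

      signS-neg-zer⇔ : signS (-S x) ≡ zer ⇔ Vanishes A B
      signS-neg-zer⇔ = mk⇔
        (λ e → Vanishes-neg (Equivalence.to (signS-scaled-zer⇔ scale (ℤ.- A) (ℤ.- B) scale>0) (trans (sym (cong signS -x≡)) e)))
        (λ v → trans (cong signS -x≡) (Equivalence.from (signS-scaled-zer⇔ scale (ℤ.- A) (ℤ.- B) scale>0) (neg-Vanishes v)))
        where
        neg-scaled : ∀ a → ℚ.- (scale ℚ.* ι a) ≡ scale ℚ.* ι (ℤ.- a)
        neg-scaled a = trans (ℚP.neg-distribʳ-* scale (ι a)) (cong (scale ℚ.*_) (sym (ι-neg a)))
        -x≡ : -S x ≡ ⟨ scale ℚ.* ι (ℤ.- A) , scale ℚ.* ι (ℤ.- B) ⟩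
        -x≡ = trans (cong -S_ x≡) (cong₂ ⟨_,_⟩ (neg-scaled A) (neg-scaled B))
        same-product : ∀ A B → ℤ.- A ℤ.* ℤ.- B ≡ A ℤ.* B
        same-product = solve-∀
        same-square : ∀ A → ℤ.- A ℤ.* ℤ.- A ≡ A ℤ.* A
        same-square = solve-∀
        neg-Vanishes : Vanishes A B → Vanishes (ℤ.- A) (ℤ.- B)
        neg-Vanishes (AB≤0 , A²≡B²D) = subst (ℤ._≤ 0ℤ) (sym (same-product A B)) AB≤0 ,
          trans (same-square A) (trans A²≡B²D (cong (ℤ._* D) (sym (same-square B))))
        Vanishes-neg : Vanishes (ℤ.- A) (ℤ.- B) → Vanishes A B
        Vanishes-neg (AB≤0 , A²≡B²D) = subst (ℤ._≤ 0ℤ) (same-product A B) AB≤0 ,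
          trans (sym (same-square A)) (trans A²≡B²D (cong (ℤ._* D) (same-square B)))

module Eigenvalue where

  open import Data.Nat as ℕ using (ℕ)
  open import Data.Integer as ℤ using (ℤ; +_; 0ℤ)
  import Data.Integer.Properties as ℤP
  open import Data.Rational.Base as ℚ using (ℚ; 0ℚ; 1ℚ; ½)
  import Data.Rational.Properties as ℚP
  open import Data.Rational.Unnormalised.Base as ℚᵘ using (mkℚᵘ; *≡*)
  import Data.Rational.Unnormalised.Properties as ℚᵘP
  open import Data.Empty using (⊥-elim)
  open import Data.Product using (Σ-syntax; _×_; _,_; proj₁; proj₂)
  open import Data.Sum using (inj₁; inj₂)
  open import Relation.Nullary using (yes; no)
  open import Relation.Binary.Definitions using (tri<; tri≈; tri>)
  open import Relation.Binary.PropositionalEquality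
  import Data.Rational.Solver
  open Data.Rational.Solver.+-*-Solver using (solve; con; _:+_; _:*_; _:-_; :-_; _:=_)
  open import Defs using (Surd; ⟨_,_⟩; module SurdOps; disc; smallestEV)
  open Surds

  private
    *-pos : ∀ {a b} → 0ℚ ℚ.< a → 0ℚ ℚ.< b → 0ℚ ℚ.< a ℚ.* b
    *-pos {a} {b} a>0 b>0 = subst (ℚ._< a ℚ.* b) (ℚP.*-zeroʳ a) (ℚP.*-monoʳ-<-pos a b>0)
      where instance _ = ℚ.positive a>0

    ½>0 : 0ℚ ℚ.< ½
    ½>0 = ℚP.positive⁻¹ ½

    recip≢0 : ∀ {i N} → i ℚ.* N ≡ 1ℚ → i ≢ 0ℚ
    recip≢0 {N = N} iN≡1 refl with trans (sym (ℚP.*-zeroˡ N)) iN≡1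
    ... | ()

    recip-neg : ∀ {i N} → i ℚ.* N ≡ 1ℚ → N ℚ.< 0ℚ → i ℚ.< 0ℚ
    recip-neg {i} {N} iN≡1 N<0 with ℚP.<-cmp i 0ℚ
    ... | tri< i<0 _ _ = i<0
    ... | tri≈ _ i≡0 _ = ⊥-elim (recip≢0 iN≡1 i≡0)
    ... | tri> _ _ i>0 = ⊥-elim (ℚP.<-asym (subst₂ ℚ._<_ iN≡1 (ℚP.*-zeroʳ i) (ℚP.*-monoʳ-<-pos i N<0)) (ℚP.positive⁻¹ 1ℚ))
      where instance _ = ℚ.positive i>0

    recip-pos : ∀ {i N} → i ℚ.* N ≡ 1ℚ → 0ℚ ℚ.< N → 0ℚ ℚ.< i
    recip-pos {i} {N} iN≡1 N>0 with ℚP.<-cmp i 0ℚ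
    ... | tri> _ _ i>0 = i>0
    ... | tri≈ _ i≡0 _ = ⊥-elim (recip≢0 iN≡1 i≡0)
    ... | tri< i<0 _ _ = ⊥-elim (ℚP.<-asym (subst₂ ℚ._<_ iN≡1 (ℚP.*-zeroʳ i) (ℚP.*-monoʳ-<-neg i N>0)) (ℚP.positive⁻¹ 1ℚ))
      where instance _ = ℚ.negative i<0

    ι/2 : ∀ z → z ℚ./ 2 ≡ ι z ℚ.* ½
    ι/2 z = ℚP.toℚᵘ-injective (ℚᵘP.≃-trans (ℚP.toℚᵘ-fromℚᵘ (mkℚᵘ z 1))
      (ℚᵘP.≃-sym (ℚᵘP.≃-trans (ℚP.toℚᵘ-homo-* (ι z) ½)
        (ℚᵘP.≃-trans (ℚᵘP.*-cong (ℚP.toℚᵘ-fromℚᵘ (mkℚᵘ z 0)) (ℚP.toℚᵘ-fromℚᵘ (mkℚᵘ (+ 1) 1)))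
          (*≡* (cong (ℤ._* + 2) (ℤP.*-identityʳ z)))))))

  module SmallestEigenvalue (k l μ : ℕ) where

    open SurdOps (disc k l μ)

    d K : ℤ
    d = + l ℤ.- + μ
    K = + k ℤ.- + μ

    s ωbound : Surd
    s = smallestEV k l μ
    ωbound = fromℕ 1 -S (fromℕ k /S s)

    αbound : ℕ → Surd
    αbound ν = (fromℕ ν *S s) /S (s -S fromℕ k)

    y-x≡-[x-y] : ∀ x y → y -S x ≡ -S (x -S y)
    y-x≡-[x-y] ⟨ a , b ⟩ ⟨ a′ , b′ ⟩ = cong₂ ⟨_,_⟩
      (solve 2 (λ a a′ → a′ :+ :- a := :- (a :+ :- a′)) refl a a′)
      (solve 2 (λ b b′ → b′ :+ :- b := :- (b :+ :- b′)) refl b b′)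

    shift-by-integer : ∀ x ω → x -S fromℤ (+ 1 ℤ.- + ω) ≡ -S ((fromℕ 1 -S x) -S fromℕ ω)
    shift-by-integer ⟨ a , b ⟩ ω = cong₂ ⟨_,_⟩
      (trans (cong (λ t → a ℚ.+ ℚ.- t) (ι-- (+ 1) (+ ω)))
        (solve 2 (λ a w → a :+ :- (con (ι (+ 1)) :- w) := :- ((con (ι (+ 1)) :+ :- a) :+ :- w)) refl a (ι (+ ω))))
      (solve 1 (λ b → b :+ :- con 0ℚ := :- ((con 0ℚ :+ :- b) :+ :- con 0ℚ)) refl b)

    private
      c e : ℚ
      c = d ℚ./ 2
      e = ℚ.- ½

      c≡ : c ≡ ι d ℚ.* ½
      c≡ = ι/2 d

      Dq≡ : Dq ≡ ι d ℚ.* ι d ℚ.+ ι (+ 4) ℚ.* ι K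
      Dq≡ = trans (ι-+ (d ℤ.* d) (+ 4 ℤ.* K)) (cong₂ ℚ._+_ (ι-* d d) (ι-* (+ 4) K))

      norm : ℚ → ℚ → ℚ
      norm a b = a ℚ.* a ℚ.- b ℚ.* b ℚ.* Dq

      inv-cancel : ∀ q → q ≢ 0ℚ → inv q ℚ.* q ≡ 1ℚ
      inv-cancel q q≢0 with q ℚP.≟ 0ℚ
      ... | yes q≡0 = ⊥-elim (q≢0 q≡0)
      ... | no q≢0′ = ℚP.*-inverseˡ q {{ℚ.≢-nonZero q≢0′}}

      invS-nondegenerate : ∀ a b → norm a b ≢ 0ℚ →
        Σ[ i ∈ ℚ ] (invS ⟨ a , b ⟩ ≡ ⟨ a ℚ.* i , ℚ.- (b ℚ.* i) ⟩ × i ℚ.* norm a b ≡ 1ℚ)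
      invS-nondegenerate a b N≢0 with norm a b ℚP.≟ 0ℚ
      ... | yes N≡0 = ⊥-elim (N≢0 N≡0)
      ... | no _    = inv (norm a b) , refl , inv-cancel (norm a b) N≢0

      invS-degenerate : ∀ a b → norm a b ≡ 0ℚ → invS ⟨ a , b ⟩ ≡ ⟨ inv (a ℚ.+ b ℚ.* (ℚ.∣ a ∣ ℚ.* inv ℚ.∣ b ∣)) , 0ℚ ⟩
      invS-degenerate a b N≡0 with norm a b ℚP.≟ 0ℚ
      ... | yes _   = refl
      ... | no N≢0 = ⊥-elim (N≢0 N≡0)

      at-unit : ∀ L R F u → R ≡ L ℚ.+ F ℚ.* (u ℚ.- 1ℚ) → u ≡ 1ℚ → R ≡ L
      at-unit L R F u R≡ u≡1 = trans R≡ (trans (cong (λ t → L ℚ.+ F ℚ.* (t ℚ.- 1ℚ)) u≡1)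
        (trans (cong (L ℚ.+_) (ℚP.*-zeroʳ F)) (ℚP.+-identityʳ L)))

    norm-s : norm c e ≡ ℚ.- ι K
    norm-s = trans (cong₂ (λ a D → a ℚ.* a ℚ.- e ℚ.* e ℚ.* D) c≡ Dq≡)
      (solve 2 (λ d K → d :* con ½ :* (d :* con ½) :- con e :* con e :* (d :* d :+ con (ι (+ 4)) :* K) := :- K) refl (ι d) (ι K))

    module ωGap (ω : ℕ) where

      A₁ : ℤ
      A₁ = + 2 ℤ.* K ℤ.* (+ 1 ℤ.- + ω) ℤ.+ + k ℤ.* d

      -- s s̄ = -(k - μ), so for k > μ: 1 - k/s - ω = (A₁ + k√D)/(2(k - μ))
      scaled-K>0 : 0ℤ ℤ.< K → ScaledIntegral (ωbound -S fromℕ ω)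
      scaled-K>0 K>0 = record { scale = q ; A = A₁ ; B = + k ; scale>0 = q>0 ; x≡ = gap≡ }
        where
        N : ℚ
        N = norm c e
        N<0 : N ℚ.< 0ℚ
        N<0 = subst (ℚ._< 0ℚ) (sym norm-s) (ℚP.neg-antimono-< (ι-positive K>0))
        inverse = invS-nondegenerate c e (λ N≡0 → ℚP.<-irrefl N≡0 N<0)
        i q : ℚ
        i = proj₁ inverse
        q = ℚ.- i ℚ.* ½
        iN≡1 : i ℚ.* N ≡ 1ℚ
        iN≡1 = proj₂ (proj₂ inverse)
        q>0 : 0ℚ ℚ.< q
        q>0 = *-pos {ℚ.- i} (ℚP.neg-antimono-< (recip-neg {i} iN≡1 N<0)) ½>0
        ι-A₁ : ι A₁ ≡ ι (+ 2) ℚ.* ι K ℚ.* (ι (+ 1) ℚ.- ι (+ ω)) ℚ.+ ι (+ k) ℚ.* ι d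
        ι-A₁ = trans (ι-+ (+ 2 ℤ.* K ℤ.* (+ 1 ℤ.- + ω)) (+ k ℤ.* d))
          (cong₂ ℚ._+_ (trans (ι-* (+ 2 ℤ.* K) (+ 1 ℤ.- + ω)) (cong₂ ℚ._*_ (ι-* (+ 2) K) (ι-- (+ 1) (+ ω)))) (ι-* (+ k) d))
        re : ℚ → ℚ
        re c′ = (ι (+ 1) ℚ.+ ℚ.- (ι (+ k) ℚ.* (c′ ℚ.* i) ℚ.+ 0ℚ ℚ.* (ℚ.- (e ℚ.* i)) ℚ.* Dq)) ℚ.+ ℚ.- ι (+ ω)
        re-identity : q ℚ.* (ι (+ 2) ℚ.* ι K ℚ.* (ι (+ 1) ℚ.- ι (+ ω)) ℚ.+ ι (+ k) ℚ.* ι d)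
                      ≡ re (ι d ℚ.* ½) ℚ.+ (ι (+ 1) ℚ.- ι (+ ω)) ℚ.* (i ℚ.* (ℚ.- ι K) ℚ.- 1ℚ)
        re-identity = solve 6 (λ i K k d w D →
                 (:- i :* con ½) :* (con (ι (+ 2)) :* K :* (con (ι (+ 1)) :- w) :+ k :* d)
                 := ((con (ι (+ 1)) :+ :- (k :* ((d :* con ½) :* i) :+ con 0ℚ :* (:- (con e :* i)) :* D)) :+ :- w)
                    :+ (con (ι (+ 1)) :- w) :* (i :* (:- K) :- con 1ℚ)) refl i (ι K) (ι (+ k)) (ι d) (ι (+ ω)) Dq
        re≡ : re c ≡ q ℚ.* ι A₁
        re≡ = trans (cong re c≡) (sym (trans (cong (q ℚ.*_) ι-A₁)
                (at-unit _ _ (ι (+ 1) ℚ.- ι (+ ω)) (i ℚ.* (ℚ.- ι K)) re-identity (trans (cong (i ℚ.*_) (sym norm-s)) iN≡1))))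
        ir≡ : (0ℚ ℚ.+ ℚ.- (ι (+ k) ℚ.* (ℚ.- (e ℚ.* i)) ℚ.+ 0ℚ ℚ.* (c ℚ.* i))) ℚ.+ ℚ.- 0ℚ ≡ q ℚ.* ι (+ k)
        ir≡ = solve 3 (λ k i c → (con 0ℚ :+ :- (k :* (:- (con e :* i)) :+ con 0ℚ :* (c :* i))) :+ :- con 0ℚ := (:- i :* con ½) :* k) refl (ι (+ k)) i c
        gap≡ : ωbound -S fromℕ ω ≡ ⟨ q ℚ.* ι A₁ , q ℚ.* ι (+ k) ⟩
        gap≡ = trans (cong (λ t → fromℕ 1 -S (fromℕ k *S t) -S fromℕ ω) (proj₁ (proj₂ inverse)))
                     (cong₂ ⟨_,_⟩ re≡ ir≡)

      A₀ : ℤ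
      A₀ = + k ℤ.+ (+ ω ℤ.- + 1) ℤ.* d

      -- for k = μ (then λ < μ), D = (λ - μ)² and s = λ - μ, so 1 - k/s - ω = A₀/(μ - λ)
      scaled-K≡0 : K ≡ 0ℤ → d ℤ.< 0ℤ → ScaledIntegral (ωbound -S fromℕ ω)
      scaled-K≡0 K≡0 d<0 = record { scale = q ; A = A₀ ; B = 0ℤ ; scale>0 = q>0 ; x≡ = gap≡ }
        where
        ι-d<0 : ι d ℚ.< 0ℚ
        ι-d<0 = ι-negative d<0
        c<0 : c ℚ.< 0ℚ
        c<0 = subst (ℚ._< 0ℚ) (sym c≡) (subst (ι d ℚ.* ½ ℚ.<_) (ℚP.*-zeroˡ ½) (ℚP.*-monoˡ-<-pos ½ ι-d<0))
          where instance _ = ℚ.positive ½>0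
        ∣c∣≡-c : ℚ.∣ c ∣ ≡ ℚ.- c
        ∣c∣≡-c with ℚP.∣p∣≡p∨∣p∣≡-p c
        ... | inj₂ e = e
        ... | inj₁ e = ⊥-elim (ℚP.<-irrefl refl (ℚP.<-≤-trans c<0 (ℚP.∣p∣≡p⇒0≤p e)))
        -- invS takes its degenerate branch, whose denominator evaluates to d
        denominator≡d : c ℚ.+ e ℚ.* (ℚ.∣ c ∣ ℚ.* inv ℚ.∣ e ∣) ≡ ι d
        denominator≡d = trans (cong (λ a → c ℚ.+ e ℚ.* (a ℚ.* ι (+ 2))) ∣c∣≡-c)
          (trans (cong (λ c → c ℚ.+ e ℚ.* (ℚ.- c ℚ.* ι (+ 2))) c≡)
            (solve 1 (λ d → d :* con ½ :+ con e :* (:- (d :* con ½) :* con (ι (+ 2))) := d) refl (ι d)))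
        i q : ℚ
        i = inv (ι d)
        q = ℚ.- i
        id≡1 : i ℚ.* ι d ≡ 1ℚ
        id≡1 = inv-cancel (ι d) (λ e → ℚP.<-irrefl e ι-d<0)
        q>0 : 0ℚ ℚ.< q
        q>0 = ℚP.neg-antimono-< (recip-neg {i} id≡1 ι-d<0)
        invS-s : invS s ≡ ⟨ i , 0ℚ ⟩
        invS-s = trans (invS-degenerate c e (trans norm-s (cong (λ t → ℚ.- ι t) K≡0)))
                       (cong (λ t → ⟨ inv t , 0ℚ ⟩) denominator≡d)
        ι-A₀ : ι A₀ ≡ ι (+ k) ℚ.+ (ι (+ ω) ℚ.- ι (+ 1)) ℚ.* ι d
        ι-A₀ = trans (ι-+ (+ k) ((+ ω ℤ.- + 1) ℤ.* d)) (cong (ι (+ k) ℚ.+_) (trans (ι-* (+ ω ℤ.- + 1) d) (cong (ℚ._* ι d) (ι-- (+ ω) (+ 1)))))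
        re : ℚ
        re = (ι (+ 1) ℚ.+ ℚ.- (ι (+ k) ℚ.* i ℚ.+ 0ℚ ℚ.* 0ℚ ℚ.* Dq)) ℚ.+ ℚ.- ι (+ ω)
        re-identity : q ℚ.* (ι (+ k) ℚ.+ (ι (+ ω) ℚ.- ι (+ 1)) ℚ.* ι d) ≡ re ℚ.+ (ℚ.- (ι (+ ω) ℚ.- ι (+ 1))) ℚ.* (i ℚ.* ι d ℚ.- 1ℚ)
        re-identity = solve 5 (λ i k d w D →
                 (:- i) :* (k :+ (w :- con (ι (+ 1))) :* d)
                 := ((con (ι (+ 1)) :+ :- (k :* i :+ con 0ℚ :* con 0ℚ :* D)) :+ :- w)
                    :+ (:- (w :- con (ι (+ 1)))) :* (i :* d :- con 1ℚ)) refl i (ι (+ k)) (ι d) (ι (+ ω)) Dq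
        re≡ : re ≡ q ℚ.* ι A₀
        re≡ = sym (trans (cong (q ℚ.*_) ι-A₀) (at-unit re _ (ℚ.- (ι (+ ω) ℚ.- ι (+ 1))) (i ℚ.* ι d) re-identity id≡1))
        ir≡ : (0ℚ ℚ.+ ℚ.- (ι (+ k) ℚ.* 0ℚ ℚ.+ 0ℚ ℚ.* i)) ℚ.+ ℚ.- 0ℚ ≡ q ℚ.* ι 0ℤ
        ir≡ = solve 2 (λ k i → (con 0ℚ :+ :- (k :* con 0ℚ :+ con 0ℚ :* i)) :+ :- con 0ℚ := (:- i) :* con (ι 0ℤ)) refl (ι (+ k)) i
        gap≡ : ωbound -S fromℕ ω ≡ ⟨ q ℚ.* ι A₀ , q ℚ.* ι 0ℤ ⟩
        gap≡ = trans (cong (λ t → fromℕ 1 -S (fromℕ k *S t) -S fromℕ ω) invS-s) (cong₂ ⟨_,_⟩ re≡ ir≡)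

    module αGap (ν α : ℕ) where

      A₂ : ℤ
      A₂ = ℤ.- (+ k ℤ.* d) ℤ.- + 2 ℤ.* K ℤ.- + 2 ℤ.* + μ ℤ.* + α

      -- s - k has norm k² - k(λ - μ) - (k - μ), which is μν by the parameter relation;
      -- then νs/(s - k) - α = (A₂ + k√D)/(2μ).
      scaled : + k ℤ.* + k ℤ.- + k ℤ.* d ℤ.- K ≡ + μ ℤ.* + ν → 0 ℕ.< μ → 0 ℕ.< ν → ScaledIntegral (αbound ν -S fromℕ α)
      scaled norm≡μν μ>0 ν>0 = record { scale = q ; A = A₂ ; B = + k ; scale>0 = q>0 ; x≡ = gap≡ }
        where
        c′ e′ N : ℚ
        c′ = c ℚ.+ ℚ.- ι (+ k)
        e′ = e ℚ.+ ℚ.- 0ℚ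
        N = norm c′ e′
        N≡μν : N ≡ ι (+ μ) ℚ.* ι (+ ν)
        N≡μν = trans (cong₂ (λ c D → (c ℚ.+ ℚ.- ι (+ k)) ℚ.* (c ℚ.+ ℚ.- ι (+ k)) ℚ.- e′ ℚ.* e′ ℚ.* D) c≡ Dq≡)
          (trans (solve 3 (λ d K k → (d :* con ½ :+ :- k) :* (d :* con ½ :+ :- k)
                                     :- (con e :+ :- con 0ℚ) :* (con e :+ :- con 0ℚ) :* (d :* d :+ con (ι (+ 4)) :* K)
                                     := k :* k :- k :* d :- K) refl (ι d) (ι K) (ι (+ k)))
            (trans (sym (trans (ι-- (+ k ℤ.* + k ℤ.- + k ℤ.* d) K) (cong (ℚ._- ι K) (trans (ι-- (+ k ℤ.* + k) (+ k ℤ.* d))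
                    (cong₂ ℚ._-_ (ι-* (+ k) (+ k)) (ι-* (+ k) d))))))
                   (trans (cong ι norm≡μν) (ι-* (+ μ) (+ ν)))))
        N>0 : 0ℚ ℚ.< N
        N>0 = subst (0ℚ ℚ.<_) (sym N≡μν) (*-pos (ι-positive (ℤ.+<+ μ>0)) (ι-positive (ℤ.+<+ ν>0)))
        inverse = invS-nondegenerate c′ e′ (λ N≡0 → ℚP.<-irrefl (sym N≡0) N>0)
        i q : ℚ
        i = proj₁ inverse
        q = ι (+ ν) ℚ.* i ℚ.* ½
        iN≡1 : i ℚ.* N ≡ 1ℚ
        iN≡1 = proj₂ (proj₂ inverse)
        q>0 : 0ℚ ℚ.< q
        q>0 = *-pos {ι (+ ν) ℚ.* i} (*-pos (ι-positive (ℤ.+<+ ν>0)) (recip-pos {i} iN≡1 N>0)) ½>0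
        ι-A₂ : ι A₂ ≡ ℚ.- (ι (+ k) ℚ.* ι d) ℚ.- ι (+ 2) ℚ.* ι K ℚ.- ι (+ 2) ℚ.* ι (+ μ) ℚ.* ι (+ α)
        ι-A₂ = trans (ι-- (ℤ.- (+ k ℤ.* d) ℤ.- + 2 ℤ.* K) (+ 2 ℤ.* + μ ℤ.* + α))
          (cong₂ ℚ._-_ (trans (ι-- (ℤ.- (+ k ℤ.* d)) (+ 2 ℤ.* K)) (cong₂ ℚ._-_ (trans (ι-neg (+ k ℤ.* d)) (cong ℚ.-_ (ι-* (+ k) d))) (ι-* (+ 2) K)))
            (trans (ι-* (+ 2 ℤ.* + μ) (+ α)) (cong (ℚ._* ι (+ α)) (ι-* (+ 2) (+ μ)))))
        re im : ℚ → ℚ → ℚ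
        re c D = ((ι (+ ν) ℚ.* c ℚ.+ 0ℚ ℚ.* e ℚ.* D) ℚ.* ((c ℚ.+ ℚ.- ι (+ k)) ℚ.* i)
                 ℚ.+ (ι (+ ν) ℚ.* e ℚ.+ 0ℚ ℚ.* c) ℚ.* (ℚ.- (e′ ℚ.* i)) ℚ.* D) ℚ.+ ℚ.- ι (+ α)
        im c D = ((ι (+ ν) ℚ.* c ℚ.+ 0ℚ ℚ.* e ℚ.* D) ℚ.* (ℚ.- (e′ ℚ.* i))
                 ℚ.+ (ι (+ ν) ℚ.* e ℚ.+ 0ℚ ℚ.* c) ℚ.* ((c ℚ.+ ℚ.- ι (+ k)) ℚ.* i)) ℚ.+ ℚ.- 0ℚ
        re-identity : q ℚ.* (ℚ.- (ι (+ k) ℚ.* ι d) ℚ.- ι (+ 2) ℚ.* ι K ℚ.- ι (+ 2) ℚ.* ι (+ μ) ℚ.* ι (+ α))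
                      ≡ re (ι d ℚ.* ½) (ι d ℚ.* ι d ℚ.+ ι (+ 4) ℚ.* ι K) ℚ.+ (ℚ.- ι (+ α)) ℚ.* (i ℚ.* (ι (+ μ) ℚ.* ι (+ ν)) ℚ.- 1ℚ)
        re-identity = solve 7 (λ ν i k d K μ α →
                 (ν :* i :* con ½) :* (:- (k :* d) :- con (ι (+ 2)) :* K :- con (ι (+ 2)) :* μ :* α)
                 := ((ν :* (d :* con ½) :+ con 0ℚ :* con e :* (d :* d :+ con (ι (+ 4)) :* K)) :* (((d :* con ½) :+ :- k) :* i)
                      :+ (ν :* con e :+ con 0ℚ :* (d :* con ½)) :* (:- (con e′ :* i)) :* (d :* d :+ con (ι (+ 4)) :* K)) :+ :- α
                    :+ (:- α) :* (i :* (μ :* ν) :- con 1ℚ)) refl (ι (+ ν)) i (ι (+ k)) (ι d) (ι K) (ι (+ μ)) (ι (+ α))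
        re≡ : re c Dq ≡ q ℚ.* ι A₂
        re≡ = trans (cong₂ re c≡ Dq≡) (sym (trans (cong (q ℚ.*_) ι-A₂)
                (at-unit _ _ (ℚ.- ι (+ α)) (i ℚ.* (ι (+ μ) ℚ.* ι (+ ν))) re-identity (trans (cong (i ℚ.*_) (sym N≡μν)) iN≡1))))
        im≡ : im c Dq ≡ q ℚ.* ι (+ k)
        im≡ = trans (cong (λ c → im c Dq) c≡)
          (solve 5 (λ ν i k d D → ((ν :* (d :* con ½) :+ con 0ℚ :* con e :* D) :* (:- (con e′ :* i))
                                    :+ (ν :* con e :+ con 0ℚ :* (d :* con ½)) :* (((d :* con ½) :+ :- k) :* i)) :+ :- con 0ℚ
                                   := (ν :* i :* con ½) :* k) refl (ι (+ ν)) i (ι (+ k)) (ι d) Dq)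
        gap≡ : αbound ν -S fromℕ α ≡ ⟨ q ℚ.* ι A₂ , q ℚ.* ι (+ k) ⟩
        gap≡ = trans (cong (λ t → ((fromℕ ν *S s) *S t) -S fromℕ α) (proj₁ (proj₂ inverse))) (cong₂ ⟨_,_⟩ re≡ im≡)

module Separation where

  open import Data.Nat as ℕ using (ℕ)
  open import Data.Integer using (ℤ; +_; 0ℤ; 1ℤ; _+_; _*_; _-_; -_; _≤_; _<_; +≤+; +<+)
  import Data.Integer.Properties as ℤP
  import Data.Nat.Properties as ℕP
  open import Data.Bool using (Bool; false)
  open import Data.Fin using (Fin)
  open import Relation.Nullary using (¬_; yes; no)
  open import Data.Product using (Σ; Σ-syntax; _×_; _,_; proj₁; proj₂)
  open import Data.Sum using (_⊎_; inj₁; inj₂)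
  open import Data.Empty using (⊥-elim)
  open import Function.Bundles using (_⇔_; mk⇔; Equivalence)
  open import Function.Construct.Composition using (_⇔-∘_)
  open import Function.Base using (_∘_)
  open import Data.Product.Function.NonDependent.Propositional using (_×-⇔_)
  open import Relation.Binary.PropositionalEquality
  open import Data.Integer.Tactic.RingSolver using (solve-∀)
  open import Defs hiding (sym)
  open Integers
  open StronglyRegular
  open Graphs
  open Quadratic
  open Surds
  open Eigenvalue

  module Tightness (k l μ ν ω α : ℕ)
    (k>0 : 0ℤ < + k) (μ>0 : 0ℤ < + μ) (μ≤k : + μ ≤ + k) (k-λ-1>0 : 0ℤ < + k - + l - 1ℤ)
    (ω≥2 : 2 ℕ.≤ ω) (α≥1 : 1 ℕ.≤ α) (ν>0 : 0 ℕ.< ν)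
    (relation : (+ ν - + k - 1ℤ) * + μ ≡ + k * (+ k - + l - 1ℤ)) where

    open SmallestEigenvalue k l μ

    D : ℤ
    D = disc k l μ

    G h : ℤ
    G = delsartePoly (+ k) (+ l) (+ μ) (+ ω)
    h = hoffmanPoly (+ ν) (+ k) (+ μ) (+ α)

    private
      R : ℤ
      R = (+ ν - + k - 1ℤ) * + μ - + k * (+ k - + l - 1ℤ)

      R≡0 : R ≡ 0ℤ
      R≡0 = ℤP.i≡j⇒i-j≡0 relation

      x>0 : 0ℤ < + ω - 1ℤ
      x>0 = i<j⇒0<j-i (+<+ ω≥2)

      K≡0⊎K>0 : K ≡ 0ℤ ⊎ 0ℤ < K
      K≡0⊎K>0 = nonNeg-zero⊎pos (ℤP.i≤j⇒0≤j-i μ≤k)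

      -- μ = k forces λ < μ, since λ ≤ k - 2
      d<0 : K ≡ 0ℤ → d < 0ℤ
      d<0 K≡0 = subst (_< 0ℤ) (sym (trans (split (+ k) (+ l) (+ μ)) (cong (λ t → t - (+ k - + l - 1ℤ) - 1ℤ) K≡0)))
        (subst (_< 0ℤ) (lemma (+ k - + l - 1ℤ)) (ℤP.neg-mono-< (ℤP.+-mono-<-≤ k-λ-1>0 (+≤+ ℕ.z≤n))))
        where
        split : ∀ k l μ → l - μ ≡ (k - μ) - (k - l - 1ℤ) - 1ℤ
        split = solve-∀
        lemma : ∀ m → - (m + 1ℤ) ≡ 0ℤ - m - 1ℤ
        lemma = solve-∀

      D>0 : 0ℤ < D
      D>0 with K≡0⊎K>0
      ... | inj₂ K>0 = subst (0ℤ <_) (ℤP.+-comm (+ 4 * K) (d * d)) (ℤP.+-mono-<-≤ (*-pos {+ 4} (+<+ (ℕ.s≤s ℕ.z≤n)) K>0) (square-nonNeg d))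
      ... | inj₁ K≡0 = subst (0ℤ <_) (sym D≡d²) (subst (0ℤ <_) (square-neg d) (*-pos -d>0 -d>0))
        where
        D≡d² : D ≡ d * d
        D≡d² = trans (cong (λ t → d * d + + 4 * t) K≡0) (trans (cong (λ t → d * d + t) (ℤP.*-zeroʳ (+ 4))) (ℤP.+-identityʳ (d * d)))
        -d>0 : 0ℤ < - d
        -d>0 = ℤP.neg-mono-< (d<0 K≡0)
        square-neg : ∀ d → - d * - d ≡ d * d
        square-neg = solve-∀

    D≢0 : D ≢ 0ℤ
    D≢0 D≡0 = ℤP.<-irrefl (sym D≡0) D>0

    open SurdOps D
    open SurdSign D D≢0

    private
      4K·G : ∀ k l μ ω → k * k * ((l - μ) * (l - μ) + + 4 * (k - μ))
                         - (+ 2 * (k - μ) * (+ 1 - ω) + k * (l - μ)) * (+ 2 * (k - μ) * (+ 1 - ω) + k * (l - μ))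
                       ≡ + 4 * (k - μ) * (k * k + (l - μ) * k * (ω - 1ℤ) - (k - μ) * (ω - 1ℤ) * (ω - 1ℤ))
      4K·G = solve-∀

      [ω-1]A₁ : ∀ k l μ ω → (ω - 1ℤ) * (+ 2 * (k - μ) * (+ 1 - ω) + k * (l - μ))
                            ≡ (k * k + (l - μ) * k * (ω - 1ℤ) - (k - μ) * (ω - 1ℤ) * (ω - 1ℤ)) - (k - μ) * (ω - 1ℤ) * (ω - 1ℤ) - k * k
      [ω-1]A₁ = solve-∀

      G≡kA₀ : ∀ k l μ ω → k * k + (l - μ) * k * (ω - 1ℤ) - (k - μ) * (ω - 1ℤ) * (ω - 1ℤ)
                          ≡ k * (k + (ω - 1ℤ) * (l - μ)) - (k - μ) * (ω - 1ℤ) * (ω - 1ℤ)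
      G≡kA₀ = solve-∀

      4μh : ∀ k l μ ν α → k * k * ((l - μ) * (l - μ) + + 4 * (k - μ))
                          - (- (k * (l - μ)) - + 2 * (k - μ) - + 2 * μ * α) * (- (k * (l - μ)) - + 2 * (k - μ) - + 2 * μ * α)
                        ≡ + 4 * μ * ((ν - α) * (α * μ + (k - μ)) - α * k * k)
                          - + 4 * ((k - μ) + μ * α) * ((ν - k - 1ℤ) * μ - k * (k - l - 1ℤ))
      4μh = solve-∀

      αA₂ : ∀ k l μ ν α → α * (- (k * (l - μ)) - + 2 * (k - μ) - + 2 * μ * α)
                          ≡ ((ν - α) * (α * μ + (k - μ)) - α * k * k) - μ * α * α - ν * (k - μ)
                            - α * ((ν - k - 1ℤ) * μ - k * (k - l - 1ℤ))
      αA₂ = solve-∀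

      norm[s-k] : ∀ k l μ ν → k * k - k * (l - μ) - (k - μ) ≡ μ * ν - ((ν - k - 1ℤ) * μ - k * (k - l - 1ℤ))
      norm[s-k] = solve-∀

      minus-pos : ∀ {a b} → 0ℤ < a + b → 0ℤ - a - b < 0ℤ
      minus-pos {a} {b} a+b>0 = subst (_< 0ℤ) (lemma a b) (ℤP.neg-mono-< a+b>0)
        where
        lemma : ∀ a b → - (a + b) ≡ 0ℤ - a - b
        lemma = solve-∀

      vanishes⇔-K>0 : 0ℤ < K → Vanishes (ωGap.A₁ ω) (+ k) ⇔ G ≡ 0ℤ
      vanishes⇔-K>0 K>0 = mk⇔ to from
        where
        A₁ = ωGap.A₁ ω
        4K>0 : 0ℤ < + 4 * K
        4K>0 = *-pos {+ 4} (+<+ (ℕ.s≤s ℕ.z≤n)) K>0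
        to : Vanishes A₁ (+ k) → G ≡ 0ℤ
        to (_ , A₁²≡k²D) = *-cancelˡ-zero 4K>0 (trans (sym (4K·G (+ k) (+ l) (+ μ) (+ ω))) (ℤP.i≡j⇒i-j≡0 (sym A₁²≡k²D)))
        from : G ≡ 0ℤ → Vanishes A₁ (+ k)
        from G≡0 = neg*pos≤0 A₁<0 k>0 , sym (ℤP.i-j≡0⇒i≡j _ _ (trans (4K·G (+ k) (+ l) (+ μ) (+ ω))
                                                      (trans (cong (+ 4 * K *_) G≡0) (ℤP.*-zeroʳ (+ 4 * K)))))
          where
          A₁<0 : A₁ < 0ℤ
          A₁<0 = *-cancelˡ-neg x>0 (subst (_< 0ℤ) (sym (trans ([ω-1]A₁ (+ k) (+ l) (+ μ) (+ ω)) (cong (λ g → g - K * (+ ω - 1ℤ) * (+ ω - 1ℤ) - + k * + k) G≡0)))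
            (minus-pos {K * (+ ω - 1ℤ) * (+ ω - 1ℤ)} {+ k * + k} (ℤP.+-mono-≤-< (*-nonNeg (*-nonNeg (ℤP.<⇒≤ K>0) (ℤP.<⇒≤ x>0)) (ℤP.<⇒≤ x>0)) (*-pos k>0 k>0))))

      vanishes⇔-K≡0 : K ≡ 0ℤ → Vanishes (ωGap.A₀ ω) 0ℤ ⇔ G ≡ 0ℤ
      vanishes⇔-K≡0 K≡0 = mk⇔ to from
        where
        A₀ = ωGap.A₀ ω
        G≡k*A₀ : G ≡ + k * A₀
        G≡k*A₀ = trans (G≡kA₀ (+ k) (+ l) (+ μ) (+ ω)) (trans (cong (λ t → + k * A₀ - t * (+ ω - 1ℤ) * (+ ω - 1ℤ)) K≡0) (ℤP.+-identityʳ (+ k * A₀)))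
        to : Vanishes A₀ 0ℤ → G ≡ 0ℤ
        to (_ , A₀²≡0) with ℤP.i*j≡0⇒i≡0∨j≡0 A₀ A₀²≡0
        ... | inj₁ A₀≡0 = trans G≡k*A₀ (trans (cong (+ k *_) A₀≡0) (ℤP.*-zeroʳ (+ k)))
        ... | inj₂ A₀≡0 = trans G≡k*A₀ (trans (cong (+ k *_) A₀≡0) (ℤP.*-zeroʳ (+ k)))
        from : G ≡ 0ℤ → Vanishes A₀ 0ℤ
        from G≡0 rewrite *-cancelˡ-zero k>0 (trans (sym G≡k*A₀) G≡0) = +≤+ ℕ.z≤n , refl

      vanishes⇔-α : Vanishes (αGap.A₂ ν α) (+ k) ⇔ h ≡ 0ℤ
      vanishes⇔-α = mk⇔ to from
        where
        A₂ = αGap.A₂ ν α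
        4μ>0 : 0ℤ < + 4 * + μ
        4μ>0 = *-pos {+ 4} (+<+ (ℕ.s≤s ℕ.z≤n)) μ>0
        k²D-A₂²≡4μh : + k * + k * D - A₂ * A₂ ≡ + 4 * + μ * h
        k²D-A₂²≡4μh = trans (4μh (+ k) (+ l) (+ μ) (+ ν) (+ α))
          (trans (cong (λ r → + 4 * + μ * h - + 4 * (K + + μ * + α) * r) R≡0)
            (trans (cong (λ t → + 4 * + μ * h - t) (ℤP.*-zeroʳ (+ 4 * (K + + μ * + α)))) (ℤP.+-identityʳ _)))
        to : Vanishes A₂ (+ k) → h ≡ 0ℤ
        to (_ , A₂²≡k²D) = *-cancelˡ-zero 4μ>0 (trans (sym k²D-A₂²≡4μh) (ℤP.i≡j⇒i-j≡0 (sym A₂²≡k²D)))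
        from : h ≡ 0ℤ → Vanishes A₂ (+ k)
        from h≡0 = neg*pos≤0 A₂<0 k>0 ,
                   sym (ℤP.i-j≡0⇒i≡j _ _ (trans k²D-A₂²≡4μh (trans (cong (+ 4 * + μ *_) h≡0) (ℤP.*-zeroʳ (+ 4 * + μ)))))
          where
          αA₂≡ : + α * A₂ ≡ 0ℤ - + μ * + α * + α - + ν * K
          αA₂≡ = trans (αA₂ (+ k) (+ l) (+ μ) (+ ν) (+ α))
            (trans (cong₂ (λ h r → h - + μ * + α * + α - + ν * K - + α * r) h≡0 R≡0)
              (trans (cong (λ t → 0ℤ - + μ * + α * + α - + ν * K - t) (ℤP.*-zeroʳ (+ α))) (ℤP.+-identityʳ _)))
          A₂<0 : A₂ < 0ℤ
          A₂<0 = *-cancelˡ-neg (+<+ α≥1) (subst (_< 0ℤ) (sym αA₂≡)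
            (minus-pos {+ μ * + α * + α} {+ ν * K} (ℤP.+-mono-<-≤ (*-pos (*-pos μ>0 (+<+ α≥1)) (+<+ α≥1)) (*-nonNeg {+ ν} (+≤+ ℕ.z≤n) (ℤP.i≤j⇒0≤j-i μ≤k)))))

    ωgap : Σ[ rep ∈ ScaledIntegral (ωbound -S fromℕ ω) ] (Vanishes (ScaledIntegral.A rep) (ScaledIntegral.B rep) ⇔ G ≡ 0ℤ)
    ωgap with K≡0⊎K>0
    ... | inj₂ K>0 = ωGap.scaled-K>0 ω K>0 , vanishes⇔-K>0 K>0
    ... | inj₁ K≡0 = ωGap.scaled-K≡0 ω K≡0 (d<0 K≡0) , vanishes⇔-K≡0 K≡0

    αgap : ScaledIntegral (αbound ν -S fromℕ α)
    αgap = αGap.scaled ν α (trans (norm[s-k] (+ k) (+ l) (+ μ) (+ ν)) (trans (cong (λ r → + μ * + ν - r) R≡0) (ℤP.+-identityʳ _)))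
                           (ℤP.drop‿+<+ μ>0) ν>0

    private
      ω-tight⇔ : signS (ωbound -S fromℕ ω) ≡ zer ⇔ G ≡ 0ℤ
      ω-tight⇔ = proj₂ ωgap ⇔-∘ signS-zer⇔ (proj₁ ωgap)

      -ω-tight⇔ : signS (-S (ωbound -S fromℕ ω)) ≡ zer ⇔ G ≡ 0ℤ
      -ω-tight⇔ = proj₂ ωgap ⇔-∘ signS-neg-zer⇔ (proj₁ ωgap)

      α-tight⇔ : signS (αbound ν -S fromℕ α) ≡ zer ⇔ h ≡ 0ℤ
      α-tight⇔ = vanishes⇔-α ⇔-∘ signS-zer⇔ αgap

      -α-tight⇔ : signS (-S (αbound ν -S fromℕ α)) ≡ zer ⇔ h ≡ 0ℤ
      -α-tight⇔ = vanishes⇔-α ⇔-∘ signS-neg-zer⇔ αgap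

      pos≢zer : pos ≢ zer
      pos≢zer ()

    ω<ωbound⇒G≢0 : fromℕ ω <S ωbound → G ≢ 0ℤ
    ω<ωbound⇒G≢0 ω<ωbound G≡0 = pos≢zer (trans (sym ω<ωbound) (Equivalence.from ω-tight⇔ G≡0))

    α<αbound⇒h≢0 : fromℕ α <S αbound ν → h ≢ 0ℤ
    α<αbound⇒h≢0 α<αbound h≡0 = pos≢zer (trans (sym α<αbound) (Equivalence.from α-tight⇔ h≡0))

    k/s∉ℤ⇒G≢0 : ¬ IsInteger (fromℕ k /S s) → G ≢ 0ℤ
    k/s∉ℤ⇒G≢0 k/s∉ℤ G≡0 = k/s∉ℤ (+ 1 - + ω ,
      subst (λ x → signS x ≡ zer) (sym (shift-by-integer (fromℕ k /S s) ω)) (Equivalence.from -ω-tight⇔ G≡0))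

    αbound∉ℤ⇒h≢0 : ¬ IsInteger (αbound ν) → h ≢ 0ℤ
    αbound∉ℤ⇒h≢0 αbound∉ℤ h≡0 = αbound∉ℤ (+ α , Equivalence.from α-tight⇔ h≡0)

    bounds-attained⇔ : (fromℕ ω ≈S ωbound × fromℕ α ≈S αbound ν) ⇔ (G ≡ 0ℤ × h ≡ 0ℤ)
    bounds-attained⇔ =
      subst (λ x → signS x ≡ zer ⇔ G ≡ 0ℤ) (sym (y-x≡-[x-y] ωbound (fromℕ ω))) -ω-tight⇔
      ×-⇔ subst (λ x → signS x ≡ zer ⇔ h ≡ 0ℤ) (sym (y-x≡-[x-y] (αbound ν) (fromℕ α))) -α-tight⇔
  module Setting {ν : ℕ} (Γ : Graph ν) (k l μ : ℕ) (srg : IsSRG Γ k l μ) (conn : Connected Γ) (nc : NonComplete Γ)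
                 (ω α : ℕ) (ωCN : IsCliqueNumber Γ ω) (αCN : IsCocliqueNumber Γ α) where

    P : InducedPath₂ Γ
    P = inducedPath₂ Γ conn nc
    open InducedPath₂ P

    ω≥2 : 2 ℕ.≤ ω
    ω≥2 = subst (ℕ._≤ ω) (count-pair Γ p≢r) (proj₂ ωCN (pair Γ p r) (pair-clique Γ p∼r))
      where
      p≢r : p ≢ r
      p≢r p≡r with trans (sym p∼r) (subst (λ z → adj Γ p z ≡ false) p≡r (irref Γ p))
      ... | ()

    α≥1 : 1 ℕ.≤ α
    α≥1 = subst (ℕ._≤ α) (count-singleton Γ p) (proj₂ αCN (singleton Γ p) (singleton-coclique Γ p))

    α≤ν : α ℕ.≤ ν
    α≤ν with proj₁ αCN
    ... | S , _ , count≡α = subst (ℕ._≤ ν) count≡α (count≤size Γ S)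

    delsarte≥0 : 0ℤ ≤ delsartePoly (+ k) (+ l) (+ μ) (+ ω)
    delsarte≥0 with proj₁ ωCN
    ... | S , clique , refl = delsarteBound Γ srg P S clique (+<+ (ℕP.<-≤-trans (ℕ.s≤s ℕ.z≤n) ω≥2))

    hoffman≥0 : 0ℤ ≤ hoffmanPoly (+ ν) (+ k) (+ μ) (+ α)
    hoffman≥0 with proj₁ αCN
    ... | S , coclique , refl = hoffmanBound Γ srg S coclique (+<+ α≥1)

    open ProductBound k l μ ν ω α (k>0 Γ srg P) (μ≤k Γ srg P) ω≥2 α≥1 α≤ν (parameterRelation Γ srg p) delsarte≥0 hoffman≥0 public
    open Tightness k l μ ν ω α (k>0 Γ srg P) (μ>0 Γ srg P) (μ≤k Γ srg P) (k-λ-1>0 Γ srg P) ω≥2 α≥1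
                   (ℕP.<-≤-trans (ℕ.s≤s ℕ.z≤n) (ℕP.≤-trans α≥1 α≤ν)) (parameterRelation Γ srg p) public

    ωα≢ν⇒separating : ω ℕ.* α ≢ ν → Separating Γ
    ωα≢ν⇒separating ωα≢ν w a wCN aCN = subst₂ (λ w a → w ℕ.* a ℕ.< ν) (sym (unique wCN ωCN)) (sym (unique aCN αCN)) (ℕP.≤∧≢⇒< ωα≤ν ωα≢ν)
      where
      unique : ∀ {IsSet : (Fin ν → Bool) → Set} {m m′} →
               (Σ _ λ S → IsSet S × count S ≡ m) × (∀ S → IsSet S → count S ℕ.≤ m) →
               (Σ _ λ S → IsSet S × count S ≡ m′) × (∀ S → IsSet S → count S ℕ.≤ m′) → m ≡ m′
      unique ((S , S∈ , refl) , max) ((S′ , S′∈ , refl) , max′) = ℕP.≤-antisym (max′ S S∈) (max S′ S′∈)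

    separatingUnlessTight : ¬ (G ≡ 0ℤ × h ≡ 0ℤ) → Separating Γ
    separatingUnlessTight ¬tight = ωα≢ν⇒separating (¬tight ∘ Equivalence.to ωα≡ν⇔bounds-tight)

    nonSeparating⇔tight : NonSeparating Γ ⇔ (G ≡ 0ℤ × h ≡ 0ℤ)
    nonSeparating⇔tight = ωα≡ν⇔bounds-tight ⇔-∘ mk⇔ to from
      where
      to : NonSeparating Γ → ω ℕ.* α ≡ ν
      to nonSep with ω ℕ.* α ℕ.≟ ν
      ... | yes ωα≡ν = ωα≡ν
      ... | no  ωα≢ν = ⊥-elim (nonSep (ωα≢ν⇒separating ωα≢ν))
      from : ω ℕ.* α ≡ ν → NonSeparating Γ
      from ωα≡ν sep = ℕP.<-irrefl ωα≡ν (sep ω α ωCN αCN)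

lemma2p3 : ∀ {ν : ℕ} (G : Graph ν) (k l μ : ℕ) →
    IsSRG G k l μ → Connected G → NonComplete G →
    ∀ (ω α : ℕ) → IsCliqueNumber G ω → IsCocliqueNumber G α →
    let open SurdOps (disc k l μ)
        s = smallestEV k l μ
        ωbound = fromℕ 1 -S (fromℕ k /S s)
        αbound = (fromℕ ν *S s) /S (s -S fromℕ k)
    in ((fromℕ ω <S ωbound ⊎ fromℕ α <S αbound) → Separating G)
       × ((¬ IsInteger (fromℕ k /S s) ⊎ ¬ IsInteger αbound) → Separating G)
       × (NonSeparating G ⇔ (fromℕ ω ≈S ωbound × fromℕ α ≈S αbound))
lemma2p3 Γ k l μ srg conn nc ω α ωCN αCN =
    (λ { (inj₁ ω<ωbound) → separatingUnlessTight (ω<ωbound⇒G≢0 ω<ωbound ∘ proj₁)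
       ; (inj₂ α<αbound) → separatingUnlessTight (α<αbound⇒h≢0 α<αbound ∘ proj₂) })
  , (λ { (inj₁ k/s∉ℤ)    → separatingUnlessTight (k/s∉ℤ⇒G≢0 k/s∉ℤ ∘ proj₁)
       ; (inj₂ αbound∉ℤ) → separatingUnlessTight (αbound∉ℤ⇒h≢0 αbound∉ℤ ∘ proj₂) })
  , ⇔-sym bounds-attained⇔ ⇔-∘ nonSeparating⇔tight
  where open Separation.Setting Γ k l μ srg conn nc ω α ωCN αCN
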